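{- Let $\mathcal{C}$ be the set of partitions in which each part occurs at most twice and any two distinct part sizes differ by at least $2$, and let $\mathcal{OD}\subset\mathcal{C}$ be the set of partitions into distinct odd parts. There exists an involution $\psi:\mathcal{C}\to\mathcal{C}$, $\lambda\mapsto\gamma$, such that $\gamma=\lambda$ if and only if $\lambda\in\mathcal{OD}$, while for $\lambda\in\mathcal{C}\setminus\mathcal{OD}$ we have $|\lambda|=|\gamma|$, $\ell_d(\lambda)=\ell_d(\gamma)$ and $\ell_r(\lambda)\not\equiv\ell_r(\gamma)\pmod 2$. Consequently, for all integers $n\ge m\ge0$, $$\#\{\lambda\in\mathcal{C}(m,n):\ell_r(\lambda)\text{ even}\}-\#\{\lambda\in\mathcal{C}(m,n):\ell_r(\lambda)\text{ odd}\}=\#\mathcal{OD}(m,n),$$ where $\mathcal{C}(m,n)$ is the set of partitions in $\mathcal{C}$ of $n$ with exactly $m$ distinct part sizes, and $\mathcal{OD}(m,n)$ is the set of partitions of $n$ into exactly $m$ distinct odd parts.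
   Context: For a partition $\lambda$, $|\lambda|$ is the sum of its parts, $\ell_d(\lambda)$ is the number of distinct part sizes occurring in $\lambda$, and $\ell_r(\lambda)$ is the number of part sizes occurring more than once in $\lambda$. -}

module Defs where

open import Data.Nat using (ℕ; _≤_; _<_; _+_; _%_; _≟_; _≤?_)
open import Data.List using (List; length; filter; deduplicate)
open import Data.Nat.ListAction using (sum)
open import Data.List.Relation.Unary.All using (All)
open import Data.List.Relation.Unary.Linked using (Linked)
open import Data.List.Relation.Unary.Unique.Propositional using (Unique)
open import Data.List.Membership.Propositional using (_∈_)
open import Data.Product using (_×_)
open import Data.Sum using (_⊎_)
open import Relation.Binary.PropositionalEquality using (_≡_)
open import Function.Bundles using (_⇔_)

IsPartition : List ℕ → Set
IsPartition xs = All (0 <_) xs × Linked (λ a b → b ≤ a) xs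

size : List ℕ → ℕ
size = sum

mult : ℕ → List ℕ → ℕ
mult a xs = length (filter (_≟ a) xs)

ℓd : List ℕ → ℕ
ℓd xs = length (deduplicate _≟_ xs)

ℓr : List ℕ → ℕ
ℓr xs = length (filter (λ a → 2 ≤? mult a xs) (deduplicate _≟_ xs))

InC : List ℕ → Set
InC xs = IsPartition xs
       × All (λ a → mult a xs ≤ 2) xs
       × All (λ a → All (λ b → a ≡ b ⊎ (b + 2 ≤ a ⊎ a + 2 ≤ b)) xs) xs

InOD : List ℕ → Set
InOD xs = IsPartition xs
        × All (λ a → a % 2 ≡ 1) xs
        × All (λ a → mult a xs ≤ 1) xs

InCmn : ℕ → ℕ → List ℕ → Set
InCmn m n xs = InC xs × size xs ≡ n × ℓd xs ≡ m

InODmn : ℕ → ℕ → List ℕ → Set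
InODmn m n xs = InOD xs × size xs ≡ n × ℓd xs ≡ m

-- xs is a duplicate-free list of exactly the objects satisfying P
-- (so length xs is the cardinality of P)
Enumerates : (List ℕ → Set) → List (List ℕ) → Set
Enumerates P xss = Unique xss × (∀ ys → (ys ∈ xss) ⇔ P ys)

-- Grouping the partitions of 𝒞 with m distinct part sizes and all parts below M by their largest
-- block (a single part or a pair) gives a recurrence in M for their generating function weighted
-- by (-1)^ℓr, which is solved by q^(m²) (q;q²)_m [2m+t, t]_q for M = 2m + t; the same grouping of
-- 𝒪𝒟 gives q^(m²) [m+s, s]_(q²) for M = 2m + 2s.  Because
--   (1-q^(2m+1)) (1-q^(2m+2)) [2m+2+t, t]_q = (1-q^(t+2m+1)) (1-q^(t+2m+2)) [2m+t, t]_q,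
-- induction on m shows (q;q²)_m [2m+t, t]_q ≡ [m+s, s]_(q²) modulo q^(t+1) when t ≤ 2s+1, so both
-- generating functions agree in every coefficient that does not feel the bound M.  This is the
-- counting identity.  It says that, for each m and n, the partitions in 𝒞(m,n) ∖ 𝒪𝒟 with ℓr even
-- are as many as those with ℓr odd; matching the two classes position by position in their
-- enumerations, and fixing everything else, gives the involution ψ.

module Submission where

open import Defs
open import Data.Nat as ℕ using (ℕ; zero; suc; _+_; _*_; _≤_; _<_; z≤n; s≤s; z<s; _≟_; _≤?_; _%_)
import Data.Nat.Properties as ℕ
import Data.Nat.Tactic.RingSolver as ℕ-Ring
open import Data.Integer as ℤ using (ℤ; 0ℤ; 1ℤ; -1ℤ; +_)
import Data.Integer.Properties as ℤ
open import Data.Integer.Tactic.RingSolver using (solve-∀)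
open import Data.Fin as Fin using (Fin)
import Data.Fin.Properties as Fin
open import Data.List using (List; []; _∷_; [_]; _++_; map; length; filter; deduplicate; drop; lookup)
import Data.List.Properties as List
open import Data.List.Relation.Unary.All as All using (All; []; _∷_)
import Data.List.Relation.Unary.All.Properties as Allₚ
open import Data.List.Relation.Unary.Any using (here; index)
open import Data.List.Relation.Unary.Any.Properties using (lookup-index)
open import Data.List.Relation.Unary.Linked using (Linked; []; [-]; _∷_; linked?)
open import Data.List.Relation.Unary.Unique.Propositional using (Unique; []; _∷_)
import Data.List.Relation.Unary.Unique.Propositional.Properties as Unique
open import Data.List.Relation.Binary.Disjoint.Propositional using (Disjoint)
open import Data.List.Membership.Propositional using (_∈_; _∉_)
import Data.List.Membership.Propositional.Properties as ∈
import Data.List.Membership.Setoid.Properties as ∈ₛ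
open import Data.Product using (Σ; _×_; _,_; proj₁; proj₂)
open import Data.Sum using (_⊎_; inj₁; inj₂)
open import Data.Empty using (⊥; ⊥-elim)
open import Function using (_∘_)
open import Function.Bundles using (_⇔_; mk⇔; Equivalence)
open import Level using (0ℓ)
open import Relation.Binary.Definitions using (DecidableEquality; tri<; tri≈; tri>)
open import Relation.Binary.PropositionalEquality hiding ([_])
import Relation.Binary.Reasoning.Setoid as SetoidReasoning
open import Relation.Nullary using (¬_; Dec; yes; no; contradiction)
open import Relation.Nullary.Decidable using (¬?; _×-dec_)
open import Relation.Unary using (Pred; Decidable)
import Axiom.UniquenessOfIdentityProofs as UIP

-- Formal power series

Series : Set
Series = ℕ → ℤ

module ≗-Reasoning = SetoidReasoning (ℕ →-setoid ℤ)

infixl 6 _⊕_ _⊖_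
infixr 7 ⊝_
infixr 7 q^_·_ 1-q^_·_

_⊕_ _⊖_ : Series → Series → Series
(f ⊕ g) n = f n ℤ.+ g n
(f ⊖ g) n = f n ℤ.- g n

⊝_ : Series → Series
(⊝ f) n = ℤ.- f n

𝟘 : Series
𝟘 _ = 0ℤ

scalar : ℤ → Series
scalar c zero = c
scalar c (suc n) = 0ℤ

𝟙 : Series
𝟙 = scalar 1ℤ

q^_·_ : ℕ → Series → Series
(q^ zero · f) n = f n
(q^ suc k · f) zero = 0ℤ
(q^ suc k · f) (suc n) = (q^ k · f) n

1-q^_·_ : ℕ → Series → Series
1-q^ k · f = f ⊖ q^ k · f

⊕-cong : ∀ {f f′ g g′} → f ≗ f′ → g ≗ g′ → f ⊕ g ≗ f′ ⊕ g′
⊕-cong p q n = cong₂ ℤ._+_ (p n) (q n)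

⊕-congʳ : ∀ f {g g′} → g ≗ g′ → f ⊕ g ≗ f ⊕ g′
⊕-congʳ f q n = cong₂ ℤ._+_ (refl {x = f n}) (q n)

⊖-cong : ∀ {f f′ g g′} → f ≗ f′ → g ≗ g′ → f ⊖ g ≗ f′ ⊖ g′
⊖-cong p q n = cong₂ ℤ._-_ (p n) (q n)

q^-cong : ∀ k {f g} → f ≗ g → q^ k · f ≗ q^ k · g
q^-cong zero p n = p n
q^-cong (suc k) p zero = refl
q^-cong (suc k) p (suc n) = q^-cong k p n

q^-⊕ : ∀ k f g → q^ k · (f ⊕ g) ≗ q^ k · f ⊕ q^ k · g
q^-⊕ zero f g n = refl
q^-⊕ (suc k) f g zero = refl
q^-⊕ (suc k) f g (suc n) = q^-⊕ k f g n

q^-⊖ : ∀ k f g → q^ k · (f ⊖ g) ≗ q^ k · f ⊖ q^ k · g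
q^-⊖ zero f g n = refl
q^-⊖ (suc k) f g zero = refl
q^-⊖ (suc k) f g (suc n) = q^-⊖ k f g n

q^-⊝ : ∀ k f → q^ k · ⊝ f ≗ ⊝ q^ k · f
q^-⊝ zero f n = refl
q^-⊝ (suc k) f zero = refl
q^-⊝ (suc k) f (suc n) = q^-⊝ k f n

q^-𝟘 : ∀ k → q^ k · 𝟘 ≗ 𝟘
q^-𝟘 zero n = refl
q^-𝟘 (suc k) zero = refl
q^-𝟘 (suc k) (suc n) = q^-𝟘 k n

q^-+ : ∀ a b f → q^ (a + b) · f ≗ q^ a · q^ b · f
q^-+ zero b f n = refl
q^-+ (suc a) b f zero = refl
q^-+ (suc a) b f (suc n) = q^-+ a b f n

q^-q^ : ∀ a b c f → a + b ≡ c → q^ a · q^ b · f ≗ q^ c · f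
q^-q^ a b c f refl n = sym (q^-+ a b f n)

q^-q^-scaled : ∀ d a b {c} f → a + b ≡ c → q^ (a * d) · q^ (b * d) · f ≗ q^ (c * d) · f
q^-q^-scaled d a b f refl = q^-q^ (a * d) (b * d) ((a + b) * d) f (sym (ℕ.*-distribʳ-+ d a b))

q^-comm : ∀ a b f → q^ a · q^ b · f ≗ q^ b · q^ a · f
q^-comm a b f n = trans (q^-q^ a b (b + a) f (ℕ.+-comm a b) n) (q^-+ b a f n)

q^-below : ∀ k f {n} → n < k → (q^ k · f) n ≡ 0ℤ
q^-below (suc k) f {zero} _ = refl
q^-below (suc k) f {suc n} (s≤s n<k) = q^-below k f n<k

q^-scalar-at : ∀ s c → (q^ s · scalar c) s ≡ c
q^-scalar-at zero c = refl
q^-scalar-at (suc s) c = q^-scalar-at s c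

q^-scalar-off : ∀ s c {n} → s ≢ n → (q^ s · scalar c) n ≡ 0ℤ
q^-scalar-off zero c {zero} s≢n = contradiction refl s≢n
q^-scalar-off zero c {suc n} _ = refl
q^-scalar-off (suc s) c {zero} _ = refl
q^-scalar-off (suc s) c {suc n} s≢n = q^-scalar-off s c (s≢n ∘ cong suc)

1-q^-cong : ∀ k {f g} → f ≗ g → 1-q^ k · f ≗ 1-q^ k · g
1-q^-cong k p n = cong₂ ℤ._-_ (p n) (q^-cong k p n)

1-q^-≡ : ∀ {a b} f → a ≡ b → 1-q^ a · f ≗ 1-q^ b · f
1-q^-≡ f refl _ = refl

1-q^-⊕ : ∀ k f g → 1-q^ k · (f ⊕ g) ≗ 1-q^ k · f ⊕ 1-q^ k · g
1-q^-⊕ k f g n rewrite q^-⊕ k f g n = regroup (f n) (g n) _ _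
  where
  regroup : ∀ a b c d → (a ℤ.+ b) ℤ.- (c ℤ.+ d) ≡ (a ℤ.- c) ℤ.+ (b ℤ.- d)
  regroup = solve-∀

1-q^-q^ : ∀ a b f → 1-q^ a · q^ b · f ≗ q^ b · 1-q^ a · f
1-q^-q^ a b f n rewrite q^-⊖ b f (q^ a · f) n | q^-comm a b f n = refl

1-q^-comm : ∀ a b f → 1-q^ a · 1-q^ b · f ≗ 1-q^ b · 1-q^ a · f
1-q^-comm a b f n rewrite q^-⊖ a f (q^ b · f) n | q^-⊖ b f (q^ a · f) n | q^-comm a b f n =
  swap-middle (f n) _ _ _
  where
  swap-middle : ∀ a b c d → (a ℤ.- b) ℤ.- (c ℤ.- d) ≡ (a ℤ.- c) ℤ.- (b ℤ.- d)
  swap-middle = solve-∀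

infix 4 _≗_mod-q^_

_≗_mod-q^_ : Series → Series → ℕ → Set
f ≗ g mod-q^ N = ∀ {n} → n < N → f n ≡ g n

≗⇒mod : ∀ {f g} N → f ≗ g → f ≗ g mod-q^ N
≗⇒mod N p {n} _ = p n

mod-trans : ∀ {f g h N} → f ≗ g mod-q^ N → g ≗ h mod-q^ N → f ≗ h mod-q^ N
mod-trans p q n<N = trans (p n<N) (q n<N)

mod-sym : ∀ {f g N} → f ≗ g mod-q^ N → g ≗ f mod-q^ N
mod-sym p n<N = sym (p n<N)

q^-mod : ∀ k {f g N} → f ≗ g mod-q^ N → q^ k · f ≗ q^ k · g mod-q^ (k + N)
q^-mod zero p n<N = p n<N
q^-mod (suc k) p {zero} _ = refl
q^-mod (suc k) p {suc n} (s≤s n<k+N) = q^-mod k p n<k+N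

1-q^-negligible : ∀ {e N} f → N ≤ e → 1-q^ e · f ≗ f mod-q^ N
1-q^-negligible {e} f N≤e {n} n<N
  rewrite q^-below e f (ℕ.<-≤-trans n<N N≤e) = ℤ.+-identityʳ (f n)

-- Coefficient n of (1 - q^(k+1)) f determines f n once the coefficients of f below n are known.
1-q^-cancel : ∀ k {f g} N → 1-q^ suc k · f ≗ 1-q^ suc k · g mod-q^ N → f ≗ g mod-q^ N
1-q^-cancel k zero p ()
1-q^-cancel k {f} {g} (suc N) p {n} n<1+N with ℕ.m<1+n⇒m<n∨m≡n n<1+N
... | inj₁ n<N = 1-q^-cancel k {f} {g} N (λ lt → p (ℕ.m<n⇒m<1+n lt)) n<N
... | inj₂ refl = begin
  f n                                              ≡⟨ restore (f n) _ ⟩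
  (1-q^ suc k · f) n ℤ.+ (q^ suc k · f) n          ≡⟨ cong₂ ℤ._+_ (p n<1+N) (q^-mod (suc k) below (ℕ.m<n+m n z<s)) ⟩
  (1-q^ suc k · g) n ℤ.+ (q^ suc k · g) n          ≡⟨ restore (g n) _ ⟨
  g n                                              ∎
  where
  open ≡-Reasoning
  below = 1-q^-cancel k {f} {g} n (λ lt → p (ℕ.m<n⇒m<1+n lt))
  restore : ∀ a b → a ≡ (a ℤ.- b) ℤ.+ b
  restore = solve-∀

-- Gaussian polynomials

oddPochhammer : ℕ → Series → Series
oddPochhammer zero f = f
oddPochhammer (suc m) f = 1-q^ suc (m + m) · oddPochhammer m f

oddPochhammer-cong : ∀ m {f g} → f ≗ g → oddPochhammer m f ≗ oddPochhammer m g
oddPochhammer-cong zero p = p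
oddPochhammer-cong (suc m) p = 1-q^-cong (suc (m + m)) (oddPochhammer-cong m p)

oddPochhammer-⊕ : ∀ m f g → oddPochhammer m (f ⊕ g) ≗ oddPochhammer m f ⊕ oddPochhammer m g
oddPochhammer-⊕ zero f g n = refl
oddPochhammer-⊕ (suc m) f g n =
  trans (1-q^-cong (suc (m + m)) (oddPochhammer-⊕ m f g) n)
        (1-q^-⊕ (suc (m + m)) (oddPochhammer m f) (oddPochhammer m g) n)

oddPochhammer-q^ : ∀ m a f → oddPochhammer m (q^ a · f) ≗ q^ a · oddPochhammer m f
oddPochhammer-q^ zero a f n = refl
oddPochhammer-q^ (suc m) a f n =
  trans (1-q^-cong (suc (m + m)) (oddPochhammer-q^ m a f) n)
        (1-q^-q^ (suc (m + m)) a (oddPochhammer m f) n)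

oddPochhammer-1-q^ : ∀ m a f → oddPochhammer m (1-q^ a · f) ≗ 1-q^ a · oddPochhammer m f
oddPochhammer-1-q^ zero a f n = refl
oddPochhammer-1-q^ (suc m) a f n =
  trans (1-q^-cong (suc (m + m)) (oddPochhammer-1-q^ m a f) n)
        (1-q^-comm (suc (m + m)) a (oddPochhammer m f) n)

-- gauss d k t is the Gaussian polynomial [k+t, t] in the variable q^d
gauss : ℕ → ℕ → ℕ → Series
gauss d zero t = 𝟙
gauss d (suc k) zero = 𝟙
gauss d (suc k) (suc t) = gauss d (suc k) t ⊕ q^ (suc t * d) · gauss d k (suc t)

gauss-zero : ∀ d k → gauss d k 0 ≗ 𝟙
gauss-zero d zero n = refl
gauss-zero d (suc k) n = refl

private
  telescope : ∀ a b c → (a ℤ.- b) ℤ.+ (b ℤ.- c) ≡ a ℤ.- c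
  telescope = solve-∀

  add-back : ∀ b x y e → b ℤ.- (x ℤ.+ y) ≡ e ℤ.- y → b ≡ e ℤ.+ x
  add-back b x y e h = begin
    b                                   ≡⟨ expand b x y ⟩
    (b ℤ.- (x ℤ.+ y)) ℤ.+ y ℤ.+ x        ≡⟨ cong (λ z → z ℤ.+ y ℤ.+ x) h ⟩
    (e ℤ.- y) ℤ.+ y ℤ.+ x                ≡⟨ contract e y x ⟩
    e ℤ.+ x                             ∎
    where
    open ≡-Reasoning
    expand : ∀ b x y → b ≡ (b ℤ.- (x ℤ.+ y)) ℤ.+ y ℤ.+ x
    expand = solve-∀
    contract : ∀ e y x → (e ℤ.- y) ℤ.+ y ℤ.+ x ≡ e ℤ.+ x
    contract = solve-∀

-- The second Pascal rule, derived from an instance of 1-q^-gauss: the two are proved together.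
gauss-pascal′ : ∀ d k t →
  1-q^ (suc k * d) · gauss d (suc k) (suc t) ≗ 1-q^ ((suc t + suc k) * d) · gauss d k (suc t) →
  gauss d (suc k) (suc t) ≗ gauss d k (suc t) ⊕ q^ (suc k * d) · gauss d (suc k) t
gauss-pascal′ d k t h n =
  add-back (B n) ((q^ K · C) n) ((q^ b · E) n) (E n) (trans (cong (λ z → B n ℤ.- z) (sym (shifted-B n))) (h n))
  where
  K = suc k * d
  b = (suc t + suc k) * d
  B = gauss d (suc k) (suc t)
  C = gauss d (suc k) t
  E = gauss d k (suc t)
  shifted-B : q^ K · B ≗ q^ K · C ⊕ q^ b · E
  shifted-B m = trans (q^-⊕ K C (q^ (suc t * d) · E) m)
                      (⊕-congʳ (q^ K · C) (q^-q^-scaled d (suc k) (suc t) E (ℕ.+-comm (suc k) (suc t))) m)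

1-q^-geometric : ∀ d t → 1-q^ (1 * d) · gauss d 1 t ≗ 1-q^ ((t + 1) * d) · 𝟙
1-q^-geometric d zero _ = refl
1-q^-geometric d (suc t) = begin
  1-q^ d′ · (G ⊕ q^ T · 𝟙)                                   ≈⟨ 1-q^-⊕ d′ G (q^ T · 𝟙) ⟩
  1-q^ d′ · G ⊕ (q^ T · 𝟙 ⊖ q^ d′ · q^ T · 𝟙)
    ≈⟨ ⊕-cong IH (⊖-cong {q^ T · 𝟙} (λ _ → refl) (q^-q^-scaled d 1 (suc t) 𝟙 (ℕ.+-comm 1 (suc t)))) ⟩
  (𝟙 ⊖ q^ T · 𝟙) ⊕ (q^ T · 𝟙 ⊖ q^ ((suc t + 1) * d) · 𝟙)      ≈⟨ (λ n → telescope (𝟙 n) _ _) ⟩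
  1-q^ ((suc t + 1) * d) · 𝟙                                  ∎
  where
  open ≗-Reasoning
  d′ = 1 * d
  T = suc t * d
  G = gauss d 1 t
  IH : 1-q^ d′ · G ≗ 1-q^ T · 𝟙
  IH n = trans (1-q^-geometric d t n) (1-q^-≡ 𝟙 (cong (_* d) (ℕ.+-comm t 1)) n)

1-q^-gauss : ∀ d k t → 1-q^ (suc k * d) · gauss d (suc k) t ≗ 1-q^ ((t + suc k) * d) · gauss d k t
1-q^-gauss d zero t = 1-q^-geometric d t
1-q^-gauss d (suc k) zero _ = refl
1-q^-gauss d (suc k) (suc t) = begin
  1-q^ a · (A ⊕ q^ T · B)                                     ≈⟨ 1-q^-⊕ a A (q^ T · B) ⟩
  1-q^ a · A ⊕ 1-q^ a · q^ T · B                              ≈⟨ ⊕-cong (1-q^-gauss d (suc k) t) (1-q^-q^ a T B) ⟩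
  1-q^ c · C ⊕ q^ T · (B ⊖ q^ a · B)                          ≈⟨ ⊕-congʳ (1-q^ c · C) (q^-⊖ T B (q^ a · B)) ⟩
  1-q^ c · C ⊕ (q^ T · B ⊖ q^ T · q^ a · B)
    ≈⟨ ⊕-congʳ (1-q^ c · C) (⊖-cong shifted-pascal′ (q^-q^-scaled d (suc t) (suc (suc k)) B refl)) ⟩
  (C ⊖ q^ c · C) ⊕ ((q^ T · E ⊕ q^ c · C) ⊖ q^ b · B)         ≈⟨ (λ n → cancel-qc (C n) _ _ _) ⟩
  1-q^ b · B                                                  ∎
  where
  open ≗-Reasoning
  a = suc (suc k) * d
  b = (suc t + suc (suc k)) * d
  c = (t + suc (suc k)) * d
  T = suc t * d
  A = gauss d (suc (suc k)) t
  B = gauss d (suc k) (suc t)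
  C = gauss d (suc k) t
  E = gauss d k (suc t)
  shifted-pascal′ : q^ T · B ≗ q^ T · E ⊕ q^ c · C
  shifted-pascal′ = begin
    q^ T · B                             ≈⟨ q^-cong T (gauss-pascal′ d k t (1-q^-gauss d k (suc t))) ⟩
    q^ T · (E ⊕ q^ (suc k * d) · C)      ≈⟨ q^-⊕ T E (q^ (suc k * d) · C) ⟩
    q^ T · E ⊕ q^ T · q^ (suc k * d) · C
      ≈⟨ ⊕-congʳ (q^ T · E) (q^-q^-scaled d (suc t) (suc k) C (sym (ℕ.+-suc t (suc k)))) ⟩
    q^ T · E ⊕ q^ c · C                  ∎
  cancel-qc : ∀ c qc te qb → (c ℤ.- qc) ℤ.+ ((te ℤ.+ qc) ℤ.- qb) ≡ (c ℤ.+ te) ℤ.- qb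
  cancel-qc = solve-∀

1-q^-gauss-q : ∀ k t → 1-q^ suc k · gauss 1 (suc k) t ≗ 1-q^ (t + suc k) · gauss 1 k t
1-q^-gauss-q k t n =
  trans (1-q^-≡ (gauss 1 (suc k) t) (sym (ℕ.*-identityʳ (suc k))) n)
        (trans (1-q^-gauss 1 k t n) (1-q^-≡ (gauss 1 k t) (ℕ.*-identityʳ (t + suc k)) n))

1-q^-gauss-q² : ∀ k s → 1-q^ suc (suc (k + k)) · gauss 2 (suc k) s ≗ 1-q^ ((s + suc k) * 2) · gauss 2 k s
1-q^-gauss-q² k s n = trans (1-q^-≡ (gauss 2 (suc k) s) (double k) n) (1-q^-gauss 2 k s n)
  where
  double : ∀ k → suc (suc (k + k)) ≡ suc k * 2
  double = ℕ-Ring.solve-∀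

private
  ≤+suc : ∀ t x → suc t ≤ t + suc x
  ≤+suc t x = ℕ.≤-trans (s≤s (ℕ.m≤m+n t x)) (ℕ.≤-reflexive (sym (ℕ.+-suc t x)))

  ≤double : ∀ {s t} m → t ≤ suc (s + s) → suc t ≤ (s + suc m) * 2
  ≤double {s} {t} m t≤ = ℕ.≤-trans (s≤s t≤) (ℕ.≤-trans (ℕ.m≤m+n _ (m + m)) (ℕ.≤-reflexive (expand s m)))
    where
    expand : ∀ s m → suc (suc (s + s)) + (m + m) ≡ (s + suc m) * 2
    expand = ℕ-Ring.solve-∀

-- Multiplied by the invertible factor 1-q^(2m+2), both sides of the case m+1 reduce by 1-q^-gauss
-- to the case m times factors 1-q^e with e > t, which are invisible modulo q^(t+1).
oddPochhammer-gauss : ∀ m {s t} → t ≤ suc (s + s) →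
  oddPochhammer m (gauss 1 (m + m) t) ≗ gauss 2 m s mod-q^ suc t
oddPochhammer-gauss zero t≤ _ = refl
oddPochhammer-gauss (suc m) {s} {t} t≤ =
  1-q^-cancel K₁ {P′ (gauss 1 (suc m + suc m) t)} {gauss 2 (suc m) s} (suc t)
    (mod-trans lhs (mod-trans (oddPochhammer-gauss m t≤) (mod-sym rhs)))
  where
  K₁ = suc (m + m)
  K₂ = suc K₁
  P = oddPochhammer m
  P′ = oddPochhammer (suc m)
  G₀ = gauss 1 (m + m) t
  G₁ = gauss 1 K₁ t
  G₂ = gauss 1 K₂ t
  P-1-q^² : ∀ a b f → P (1-q^ a · 1-q^ b · f) ≗ 1-q^ a · 1-q^ b · P f
  P-1-q^² a b f n = trans (oddPochhammer-1-q^ m a (1-q^ b · f) n)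
                          (1-q^-cong a (oddPochhammer-1-q^ m b f) n)
  two-steps : 1-q^ K₂ · 1-q^ K₁ · G₂ ≗ 1-q^ (t + K₂) · 1-q^ (t + K₁) · G₀
  two-steps = begin
    1-q^ K₂ · 1-q^ K₁ · G₂             ≈⟨ 1-q^-comm K₂ K₁ G₂ ⟩
    1-q^ K₁ · 1-q^ K₂ · G₂             ≈⟨ 1-q^-cong K₁ (1-q^-gauss-q K₁ t) ⟩
    1-q^ K₁ · 1-q^ (t + K₂) · G₁       ≈⟨ 1-q^-comm K₁ (t + K₂) G₁ ⟩
    1-q^ (t + K₂) · 1-q^ K₁ · G₁       ≈⟨ 1-q^-cong (t + K₂) (1-q^-gauss-q (m + m) t) ⟩
    1-q^ (t + K₂) · 1-q^ (t + K₁) · G₀ ∎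
    where open ≗-Reasoning
  lhs : 1-q^ K₂ · P′ (gauss 1 (suc m + suc m) t) ≗ P G₀ mod-q^ suc t
  lhs = mod-trans (≗⇒mod (suc t) exact)
          (mod-trans (1-q^-negligible (1-q^ (t + K₁) · P G₀) (≤+suc t K₁))
                     (1-q^-negligible (P G₀) (≤+suc t (m + m))))
    where
    open ≗-Reasoning
    exact : 1-q^ K₂ · P′ (gauss 1 (suc m + suc m) t) ≗ 1-q^ (t + K₂) · 1-q^ (t + K₁) · P G₀
    exact = begin
      1-q^ K₂ · P′ (gauss 1 (suc m + suc m) t)
        ≈⟨ (λ n → cong (λ j → (1-q^ K₂ · P′ (gauss 1 j t)) n) (ℕ.+-suc (suc m) m)) ⟩
      1-q^ K₂ · 1-q^ K₁ · P G₂                 ≈⟨ P-1-q^² K₂ K₁ G₂ ⟨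
      P (1-q^ K₂ · 1-q^ K₁ · G₂)               ≈⟨ oddPochhammer-cong m two-steps ⟩
      P (1-q^ (t + K₂) · 1-q^ (t + K₁) · G₀)   ≈⟨ P-1-q^² (t + K₂) (t + K₁) G₀ ⟩
      1-q^ (t + K₂) · 1-q^ (t + K₁) · P G₀     ∎
  rhs : 1-q^ K₂ · gauss 2 (suc m) s ≗ gauss 2 m s mod-q^ suc t
  rhs = mod-trans (≗⇒mod (suc t) (1-q^-gauss-q² m s))
                  (1-q^-negligible (gauss 2 m s) (≤double {s} m t≤))

signedClosed : ℕ → ℕ → Series
signedClosed m t = q^ (m * m) · oddPochhammer m (gauss 1 (m + m) t)

odClosed : ℕ → ℕ → Series
odClosed m s = q^ (m * m) · gauss 2 m s

private
  square-suc : ∀ m → suc (m + m) + m * m ≡ suc m * suc m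
  square-suc = ℕ-Ring.solve-∀

signedClosed-zero : ∀ m → signedClosed (suc m) 0 ≗ q^ suc (m + m) · 1-q^ suc (m + m) · signedClosed m 0
signedClosed-zero m = begin
  q^ (suc m * suc m) · 1-q^ K · P 𝟙
    ≈⟨ q^-cong (suc m * suc m) (1-q^-cong K (oddPochhammer-cong m (λ n → sym (gauss-zero 1 (m + m) n)))) ⟩
  q^ (suc m * suc m) · 1-q^ K · P G           ≈⟨ q^-q^ K (m * m) (suc m * suc m) (1-q^ K · P G) (square-suc m) ⟨
  q^ K · q^ (m * m) · 1-q^ K · P G            ≈⟨ q^-cong K (1-q^-q^ K (m * m) (P G)) ⟨
  q^ K · 1-q^ K · q^ (m * m) · P G            ∎
  where
  open ≗-Reasoning
  K = suc (m + m)
  P = oddPochhammer m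
  G = gauss 1 (m + m) 0

signedClosed-suc : ∀ m t → signedClosed (suc m) (suc t) ≗
  signedClosed (suc m) t ⊕ q^ suc (suc t + (m + m)) · 1-q^ suc (suc t + (m + m)) · signedClosed m (suc t)
signedClosed-suc m t = begin
  q^ S · P′ (G₂ ⊕ q^ T · G₁)             ≈⟨ q^-cong S (oddPochhammer-⊕ (suc m) G₂ (q^ T · G₁)) ⟩
  q^ S · (P′ G₂ ⊕ P′ (q^ T · G₁))        ≈⟨ q^-⊕ S (P′ G₂) (P′ (q^ T · G₁)) ⟩
  q^ S · P′ G₂ ⊕ q^ S · P′ (q^ T · G₁)   ≈⟨ ⊕-congʳ (q^ S · P′ G₂) new-block ⟩
  q^ S · P′ G₂ ⊕ q^ E · 1-q^ E · q^ (m * m) · P G₀ ∎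
  where
  open ≗-Reasoning
  S = suc m * suc m
  T = suc t * 1
  K = suc (m + m)
  E = suc (suc t + (m + m))
  P = oddPochhammer m
  P′ = oddPochhammer (suc m)
  G₀ = gauss 1 (m + m) (suc t)
  G₁ = gauss 1 (m + suc m) (suc t)
  G₂ = gauss 1 (suc m + suc m) t
  exponent : ∀ m t → suc m * suc m + suc t * 1 ≡ suc (suc t + (m + m)) + m * m
  exponent = ℕ-Ring.solve-∀
  lower-block : P′ G₁ ≗ 1-q^ E · P G₀
  lower-block = begin
    1-q^ K · P G₁                  ≈⟨ oddPochhammer-1-q^ m K G₁ ⟨
    P (1-q^ K · G₁)
      ≈⟨ oddPochhammer-cong m (λ n → cong (λ j → (1-q^ K · gauss 1 j (suc t)) n) (ℕ.+-suc m m)) ⟩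
    P (1-q^ K · gauss 1 K (suc t)) ≈⟨ oddPochhammer-cong m (1-q^-gauss-q (m + m) (suc t)) ⟩
    P (1-q^ (suc t + K) · G₀)      ≈⟨ oddPochhammer-cong m (1-q^-≡ G₀ (ℕ.+-suc (suc t) (m + m))) ⟩
    P (1-q^ E · G₀)                ≈⟨ oddPochhammer-1-q^ m E G₀ ⟩
    1-q^ E · P G₀                  ∎
  new-block : q^ S · P′ (q^ T · G₁) ≗ q^ E · 1-q^ E · q^ (m * m) · P G₀
  new-block = begin
    q^ S · P′ (q^ T · G₁)              ≈⟨ q^-cong S (oddPochhammer-q^ (suc m) T G₁) ⟩
    q^ S · q^ T · P′ G₁                ≈⟨ q^-q^ S T (E + m * m) (P′ G₁) (exponent m t) ⟩
    q^ (E + m * m) · P′ G₁             ≈⟨ q^-cong (E + m * m) lower-block ⟩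
    q^ (E + m * m) · 1-q^ E · P G₀     ≈⟨ q^-+ E (m * m) (1-q^ E · P G₀) ⟩
    q^ E · q^ (m * m) · 1-q^ E · P G₀  ≈⟨ q^-cong E (1-q^-q^ E (m * m) (P G₀)) ⟨
    q^ E · 1-q^ E · q^ (m * m) · P G₀  ∎

odClosed-zero : ∀ m → odClosed (suc m) 0 ≗ q^ suc (m + m) · odClosed m 0
odClosed-zero m n = trans (q^-cong (suc m * suc m) (λ n → sym (gauss-zero 2 m n)) n)
                          (sym (q^-q^ (suc (m + m)) (m * m) (suc m * suc m) (gauss 2 m 0) (square-suc m) n))

odClosed-suc : ∀ m s → odClosed (suc m) (suc s) ≗
  odClosed (suc m) s ⊕ q^ suc ((suc s + m) + (suc s + m)) · odClosed m (suc s)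
odClosed-suc m s = begin
  q^ S · (gauss 2 (suc m) s ⊕ q^ T · G)       ≈⟨ q^-⊕ S (gauss 2 (suc m) s) (q^ T · G) ⟩
  q^ S · gauss 2 (suc m) s ⊕ q^ S · q^ T · G  ≈⟨ ⊕-congʳ (q^ S · gauss 2 (suc m) s) new-block ⟩
  q^ S · gauss 2 (suc m) s ⊕ q^ E · q^ (m * m) · G ∎
  where
  open ≗-Reasoning
  S = suc m * suc m
  T = suc s * 2
  E = suc ((suc s + m) + (suc s + m))
  G = gauss 2 m (suc s)
  exponent : ∀ m s → suc m * suc m + suc s * 2 ≡ suc ((suc s + m) + (suc s + m)) + m * m
  exponent = ℕ-Ring.solve-∀
  new-block : q^ S · q^ T · G ≗ q^ E · q^ (m * m) · G
  new-block n = trans (q^-q^ S T (E + m * m) G (exponent m s) n) (q^-+ E (m * m) G n)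


-- Lists

module _ {A : Set} where

  filter-cong-All : ∀ {P Q : Pred A 0ℓ} (P? : Decidable P) (Q? : Decidable Q) {xs} →
                    All (λ x → (P x → Q x) × (Q x → P x)) xs → filter P? xs ≡ filter Q? xs
  filter-cong-All P? Q? [] = refl
  filter-cong-All {Q = Q} P? Q? {x ∷ xs} ((to , from) ∷ rest) = by-cases (Q? x)
    where
    by-cases : Dec (Q x) → filter P? (x ∷ xs) ≡ filter Q? (x ∷ xs)
    by-cases (yes q) = trans (List.filter-accept P? (from q))
                         (trans (cong (x ∷_) (filter-cong-All P? Q? rest)) (sym (List.filter-accept Q? q)))
    by-cases (no ¬q) = trans (List.filter-reject P? (¬q ∘ to))
                         (trans (filter-cong-All P? Q? rest) (sym (List.filter-reject Q? ¬q)))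

  length-filter-split : ∀ {P : Pred A 0ℓ} (P? : Decidable P) xs →
                        length xs ≡ length (filter P? xs) + length (filter (¬? ∘ P?) xs)
  length-filter-split P? [] = refl
  length-filter-split {P} P? (x ∷ xs) = by-cases (P? x)
    where
    IH = length-filter-split P? xs
    by-cases : Dec (P x) →
               suc (length xs) ≡ length (filter P? (x ∷ xs)) + length (filter (¬? ∘ P?) (x ∷ xs))
    by-cases (yes p) = trans (cong suc IH)
      (sym (cong₂ _+_ (cong length (List.filter-accept P? {x} {xs} p))
                      (cong length (List.filter-reject (¬? ∘ P?) {x} {xs} (λ ¬p → ¬p p)))))
    by-cases (no ¬p) = trans (cong suc IH)
      (sym (trans (cong₂ _+_ (cong length (List.filter-reject P? {x} {xs} ¬p))
                             (cong length (List.filter-accept (¬? ∘ P?) {x} {xs} ¬p)))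
                  (ℕ.+-suc _ _)))

  filter-absorb : ∀ {P Q : Pred A 0ℓ} (P? : Decidable P) (Q? : Decidable Q) → (∀ {x} → P x → Q x) →
                  ∀ xs → filter P? (filter Q? xs) ≡ filter P? xs
  filter-absorb P? Q? P⇒Q [] = refl
  filter-absorb {P} {Q} P? Q? P⇒Q (x ∷ xs) = by-cases (P? x)
    where
    IH = filter-absorb P? Q? P⇒Q xs
    by-cases : Dec (P x) → filter P? (filter Q? (x ∷ xs)) ≡ filter P? (x ∷ xs)
    by-cases (yes p) = begin
      filter P? (filter Q? (x ∷ xs))   ≡⟨ cong (filter P?) (List.filter-accept Q? (P⇒Q p)) ⟩
      filter P? (x ∷ filter Q? xs)     ≡⟨ List.filter-accept P? p ⟩
      x ∷ filter P? (filter Q? xs)     ≡⟨ cong (x ∷_) IH ⟩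
      x ∷ filter P? xs                 ≡⟨ List.filter-accept P? p ⟨
      filter P? (x ∷ xs)               ∎
      where open ≡-Reasoning
    by-cases (no ¬p) = trans (skip (Q? x)) (trans IH (sym (List.filter-reject P? ¬p)))
      where
      skip : Dec (Q x) → filter P? (filter Q? (x ∷ xs)) ≡ filter P? (filter Q? xs)
      skip (yes q) = trans (cong (filter P?) (List.filter-accept Q? q)) (List.filter-reject P? ¬p)
      skip (no ¬q) = cong (filter P?) (List.filter-reject Q? ¬q)

  disjoint-by : ∀ {xs ys : List A} (P : Pred A 0ℓ) → All P xs → All (¬_ ∘ P) ys → Disjoint xs ys
  disjoint-by P all-P all-¬P (v∈xs , v∈ys) = All.lookup all-¬P v∈ys (All.lookup all-P v∈xs)

-- Partitions

%2-cases : ∀ k → k % 2 ≡ 0 ⊎ k % 2 ≡ 1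
%2-cases zero = inj₁ refl
%2-cases (suc zero) = inj₂ refl
%2-cases (suc (suc k)) = %2-cases k

even-double : ∀ k → (k + k) % 2 ≡ 0
even-double zero = refl
even-double (suc k) rewrite ℕ.+-suc k k = even-double k

odd-double : ∀ k → suc (k + k) % 2 ≡ 1
odd-double zero = refl
odd-double (suc k) rewrite ℕ.+-suc k k = odd-double k

parity-clash : ∀ {k} → k % 2 ≡ 0 → k % 2 ≡ 1 → ⊥
parity-clash even odd = contradiction (trans (sym even) odd) λ ()

odd⇒suc-even : ∀ {a} → a % 2 ≡ 1 → suc a % 2 ≡ 0
odd⇒suc-even {suc zero} _ = refl
odd⇒suc-even {suc (suc a)} h = odd⇒suc-even {a} h

odd-gap : ∀ {a b} → a % 2 ≡ 1 → b % 2 ≡ 1 → a < b → suc a < b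
odd-gap {a} oa ob a<b with ℕ.m≤n⇒m<n∨m≡n a<b
... | inj₁ 1+a<b = 1+a<b
... | inj₂ refl = ⊥-elim (parity-clash {suc a} (odd⇒suc-even {a} oa) ob)

private
  -1^-+2 : ∀ k → -1ℤ ℤ.^ suc (suc k) ≡ -1ℤ ℤ.^ k
  -1^-+2 k = trans (ℤ.-1*i≡-i _) (trans (cong ℤ.-_ (ℤ.-1*i≡-i _)) (ℤ.neg-involutive _))

-1^-even : ∀ {k} → k % 2 ≡ 0 → -1ℤ ℤ.^ k ≡ 1ℤ
-1^-even {zero} _ = refl
-1^-even {suc (suc k)} h = trans (-1^-+2 k) (-1^-even {k} h)

-1^-odd : ∀ {k} → k % 2 ≡ 1 → -1ℤ ℤ.^ k ≡ -1ℤ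
-1^-odd {suc zero} _ = refl
-1^-odd {suc (suc k)} h = trans (-1^-+2 k) (-1^-odd {k} h)

-1^-suc : ∀ k → -1ℤ ℤ.^ suc k ≡ ℤ.- (-1ℤ ℤ.^ k)
-1^-suc k = ℤ.-1*i≡-i _

mult-head : ∀ x r → mult x (x ∷ r) ≡ suc (mult x r)
mult-head x r = cong length (List.filter-accept (_≟ x) refl)

mult-pair : ∀ x r → mult x (x ∷ x ∷ r) ≡ 2 + mult x r
mult-pair x r = trans (mult-head x (x ∷ r)) (cong suc (mult-head x r))

mult-other : ∀ {x a} r → x ≢ a → mult a (x ∷ r) ≡ mult a r
mult-other r x≢a = cong length (List.filter-reject (_≟ _) x≢a)

mult-absent : ∀ {a r} → All (_≢ a) r → mult a r ≡ 0
mult-absent a∉r = cong length (List.filter-none (_≟ _) a∉r)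

mult-tail : ∀ a x r → mult a r ≤ mult a (x ∷ r)
mult-tail a x r with x ≟ a
... | yes refl = ℕ.≤-trans (ℕ.n≤1+n _) (ℕ.≤-reflexive (sym (mult-head a r)))
... | no x≢a = ℕ.≤-reflexive (sym (mult-other r x≢a))

mult≡0⇒absent : ∀ {a} r → mult a r ≡ 0 → All (_≢ a) r
mult≡0⇒absent [] _ = []
mult≡0⇒absent {a} (y ∷ r) h with y ≟ a
... | yes refl = contradiction (trans (sym (mult-head a r)) h) λ ()
... | no y≢a = y≢a ∷ mult≡0⇒absent r (trans (sym (mult-other r y≢a)) h)

Above : ℕ → List ℕ → Set
Above x r = All (λ y → suc y < x) r

data IsC : List ℕ → Set where
  empty  : IsC []
  single : ∀ {x r} → 0 < x → Above x r → IsC r → IsC (x ∷ r)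
  double : ∀ {x r} → 0 < x → Above x r → IsC r → IsC (x ∷ x ∷ r)

Separated : ℕ → ℕ → Set
Separated a b = a ≡ b ⊎ (b + 2 ≤ a ⊎ a + 2 ≤ b)

Above⇒≢ : ∀ {x r} → Above x r → All (x ≢_) r
Above⇒≢ = All.map λ 1+y<x x≡y → ℕ.<-irrefl (sym x≡y) (ℕ.<-trans (ℕ.n<1+n _) 1+y<x)

Above⇒≤ : ∀ {x r} → Above x r → All (_≤ x) r
Above⇒≤ = All.map λ 1+y<x → ℕ.<⇒≤ (ℕ.<-trans (ℕ.n<1+n _) 1+y<x)

+2≤⇒1+< : ∀ {y x} → y + 2 ≤ x → suc y < x
+2≤⇒1+< {y} = ℕ.≤-trans (ℕ.≤-reflexive (ℕ.+-comm 2 y))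

1+<⇒+2≤ : ∀ {y x} → suc y < x → y + 2 ≤ x
1+<⇒+2≤ {y} = ℕ.≤-trans (ℕ.≤-reflexive (ℕ.+-comm y 2))

private
  R≥ : ℕ → ℕ → Set
  R≥ a b = b ≤ a

  linked-tail : ∀ {x r} → Linked R≥ (x ∷ r) → Linked R≥ r
  linked-tail [-] = []
  linked-tail (_ ∷ l) = l

  linked-head : ∀ {x r} → Linked R≥ (x ∷ r) → All (_≤ x) r
  linked-head [-] = []
  linked-head (y≤x ∷ l) = y≤x ∷ All.map (λ z≤y → ℕ.≤-trans z≤y y≤x) (linked-head l)

InC-tail : ∀ {x r} → InC (x ∷ r) → InC r
InC-tail {x} {r} ((_ ∷ pos , linked) , _ ∷ mults , _ ∷ seps) =
  (pos , linked-tail linked) , All.map (λ {a} → ℕ.≤-trans (mult-tail a x r)) mults , All.map All.tail seps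

separated⇒above : ∀ {x z} → z < x → Separated x z → suc z < x
separated⇒above z<x (inj₁ refl) = ⊥-elim (ℕ.<-irrefl refl z<x)
separated⇒above z<x (inj₂ (inj₁ z+2≤x)) = +2≤⇒1+< z+2≤x
separated⇒above {x} z<x (inj₂ (inj₂ x+2≤z)) =
  ⊥-elim (ℕ.<-asym z<x (ℕ.<-trans (ℕ.n<1+n x) (+2≤⇒1+< x+2≤z)))

InC⇒IsC-step : ∀ {x y r} → InC (x ∷ y ∷ r) → Dec (x ≡ y) → IsC r → IsC (y ∷ r) → IsC (x ∷ y ∷ r)
InC⇒IsC-step {x} {.x} {r} ((pos ∷ _ , linked) , mult-x ∷ _ , sep-x ∷ _) (yes refl) c-r _ = double pos above c-r
  where
  x∉r : All (_≢ x) r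
  x∉r = mult≡0⇒absent r (ℕ.n≤0⇒n≡0 (ℕ.≤-pred (ℕ.≤-pred (subst (_≤ 2) (mult-pair x r) mult-x))))
  above : Above x r
  above = All.zipWith (λ (z≤x , z≢x , sep) → separated⇒above (ℕ.≤∧≢⇒< z≤x z≢x) sep)
            (All.tail (linked-head linked) , All.zip (x∉r , All.tail (All.tail sep-x)))
InC⇒IsC-step {x} {y} {r} ((pos ∷ _ , linked) , _ , sep-x ∷ _) (no x≢y) _ c-yr = single pos above c-yr
  where
  y<x : y < x
  y<x = ℕ.≤∧≢⇒< (All.head (linked-head linked)) (x≢y ∘ sym)
  above : Above x (y ∷ r)
  above = All.zipWith (λ (z≤y , sep) → separated⇒above (ℕ.≤-<-trans z≤y y<x) sep)
            (ℕ.≤-refl ∷ linked-head (linked-tail linked) , All.tail sep-x)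

InC⇒IsC : ∀ xs → InC xs → IsC xs
InC⇒IsC [] _ = empty
InC⇒IsC (x ∷ []) ((pos ∷ _ , _) , _) = single pos [] empty
InC⇒IsC (x ∷ y ∷ r) c =
  InC⇒IsC-step c (x ≟ y) (InC⇒IsC r (InC-tail (InC-tail c))) (InC⇒IsC (y ∷ r) (InC-tail c))

private
  IsC-positive : ∀ {xs} → IsC xs → All (0 <_) xs
  IsC-positive empty = []
  IsC-positive (single pos _ c) = pos ∷ IsC-positive c
  IsC-positive (double pos _ c) = pos ∷ pos ∷ IsC-positive c

  linked-cons : ∀ {x r} → All (_≤ x) r → Linked R≥ r → Linked R≥ (x ∷ r)
  linked-cons [] _ = [-]
  linked-cons (y≤x ∷ _) l = y≤x ∷ l

  IsC-linked : ∀ {xs} → IsC xs → Linked R≥ xs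
  IsC-linked empty = []
  IsC-linked (single _ above c) = linked-cons (Above⇒≤ above) (IsC-linked c)
  IsC-linked (double _ above c) = ℕ.≤-refl ∷ linked-cons (Above⇒≤ above) (IsC-linked c)

  mult-above : ∀ {x r} → Above x r → mult x r ≡ 0
  mult-above above = mult-absent (All.map (λ x≢y → x≢y ∘ sym) (Above⇒≢ above))

  mult-below : ∀ {x r} → Above x r → All (λ a → mult a (x ∷ r) ≡ mult a r) r
  mult-below {r = r} above = All.map (mult-other r) (Above⇒≢ above)

  IsC-mult : ∀ {xs} → IsC xs → All (λ a → mult a xs ≤ 2) xs
  IsC-mult empty = []
  IsC-mult {x ∷ r} (single _ above c) =
    ℕ.≤-trans (ℕ.≤-reflexive (trans (mult-head x r) (cong suc (mult-above above)))) (s≤s z≤n)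
    ∷ All.zipWith (λ (eq , ≤2) → ℕ.≤-trans (ℕ.≤-reflexive eq) ≤2) (mult-below above , IsC-mult c)
  IsC-mult {x ∷ x ∷ r} (double _ above c) = twice ∷ twice
    ∷ All.zipWith (λ (≢ , ≤2) → ℕ.≤-trans (ℕ.≤-reflexive (trans (mult-other (x ∷ r) ≢) (mult-other r ≢))) ≤2)
                  (Above⇒≢ above , IsC-mult c)
    where
    twice : mult x (x ∷ x ∷ r) ≤ 2
    twice = ℕ.≤-reflexive (trans (mult-pair x r) (cong (suc ∘ suc) (mult-above above)))

  above⇒separated : ∀ {x r} → Above x r → All (Separated x) r
  above⇒separated = All.map (inj₂ ∘ inj₁ ∘ 1+<⇒+2≤)

  below⇒separated : ∀ {x r} → Above x r → All (λ a → Separated a x) r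
  below⇒separated = All.map (inj₂ ∘ inj₂ ∘ 1+<⇒+2≤)

  IsC-separated : ∀ {xs} → IsC xs → All (λ a → All (Separated a) xs) xs
  IsC-separated empty = []
  IsC-separated (single _ above c) =
    (inj₁ refl ∷ above⇒separated above)
    ∷ All.zipWith (λ (sep , row) → sep ∷ row) (below⇒separated above , IsC-separated c)
  IsC-separated (double _ above c) =
    (inj₁ refl ∷ inj₁ refl ∷ above⇒separated above)
    ∷ (inj₁ refl ∷ inj₁ refl ∷ above⇒separated above)
    ∷ All.zipWith (λ (sep , row) → sep ∷ sep ∷ row) (below⇒separated above , IsC-separated c)

IsC⇒InC : ∀ {xs} → IsC xs → InC xs
IsC⇒InC c = (IsC-positive c , IsC-linked c) , IsC-mult c , IsC-separated c

private
  dedup : List ℕ → List ℕ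
  dedup = deduplicate _≟_

  All-dedup : ∀ {P : Pred ℕ 0ℓ} {r} → All P r → All P (dedup r)
  All-dedup {r = r} ps = All.tabulate (λ z∈ → All.lookup ps (∈.∈-deduplicate⁻ _≟_ r z∈))

  dedup-fresh : ∀ {x r} → All (x ≢_) r → dedup (x ∷ r) ≡ x ∷ dedup r
  dedup-fresh x∉r = cong (_ ∷_) (List.filter-all (¬? ∘ (_ ≟_)) (All-dedup x∉r))

  dedup-double : ∀ x r → dedup (x ∷ x ∷ r) ≡ dedup (x ∷ r)
  dedup-double x r = cong (x ∷_) (trans (List.filter-reject (¬? ∘ (x ≟_)) (λ x≢x → x≢x refl))
                                         (List.filter-idem (¬? ∘ (x ≟_)) (dedup r)))

ℓd-single : ∀ {x r} → All (x ≢_) r → ℓd (x ∷ r) ≡ suc (ℓd r)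
ℓd-single x∉r = cong length (dedup-fresh x∉r)

ℓd-double : ∀ {x r} → All (x ≢_) r → ℓd (x ∷ x ∷ r) ≡ suc (ℓd r)
ℓd-double {x} {r} x∉r = trans (cong length (dedup-double x r)) (ℓd-single x∉r)

private
  repeated? : (xs : List ℕ) → Decidable (λ a → 2 ≤ mult a xs)
  repeated? xs a = 2 ≤? mult a xs

  repeated-cong : ∀ {xs ys} L → All (λ a → mult a xs ≡ mult a ys) L →
                  filter (repeated? xs) L ≡ filter (repeated? ys) L
  repeated-cong {xs} {ys} L eqs =
    filter-cong-All (repeated? xs) (repeated? ys) (All.map (λ eq → subst (2 ≤_) eq , subst (2 ≤_) (sym eq)) eqs)

ℓr-single : ∀ {x r} → All (x ≢_) r → ℓr (x ∷ r) ≡ ℓr r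
ℓr-single {x} {r} x∉r = begin
  length (filter (repeated? (x ∷ r)) (dedup (x ∷ r)))  ≡⟨ cong (length ∘ filter (repeated? (x ∷ r))) (dedup-fresh x∉r) ⟩
  length (filter (repeated? (x ∷ r)) (x ∷ dedup r))    ≡⟨ cong length (List.filter-reject (repeated? (x ∷ r)) once) ⟩
  length (filter (repeated? (x ∷ r)) (dedup r))
    ≡⟨ cong length (repeated-cong {x ∷ r} {r} (dedup r) (All-dedup (All.map (mult-other r) x∉r))) ⟩
  ℓr r                                                  ∎
  where
  open ≡-Reasoning
  once : ¬ 2 ≤ mult x (x ∷ r)
  once 2≤ rewrite mult-head x r | mult-absent (All.map (λ x≢y → x≢y ∘ sym) x∉r) with 2≤
  ... | s≤s ()

ℓr-double : ∀ {x r} → All (x ≢_) r → ℓr (x ∷ x ∷ r) ≡ suc (ℓr r)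
ℓr-double {x} {r} x∉r = begin
  length (filter (repeated? xxr) (dedup xxr))
    ≡⟨ cong (length ∘ filter (repeated? xxr)) (trans (dedup-double x r) (dedup-fresh x∉r)) ⟩
  length (filter (repeated? xxr) (x ∷ dedup r))
    ≡⟨ cong length (List.filter-accept (repeated? xxr) twice) ⟩
  suc (length (filter (repeated? xxr) (dedup r)))
    ≡⟨ cong (suc ∘ length) (repeated-cong {xxr} {r} (dedup r) (All-dedup (All.map mult-xxr x∉r))) ⟩
  suc (ℓr r)                                          ∎
  where
  open ≡-Reasoning
  xxr = x ∷ x ∷ r
  twice : 2 ≤ mult x xxr
  twice rewrite mult-pair x r = s≤s (s≤s z≤n)
  mult-xxr : ∀ {a} → x ≢ a → mult a xxr ≡ mult a r
  mult-xxr x≢a = trans (mult-other (x ∷ r) x≢a) (mult-other r x≢a)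

InOD? : Decidable InOD
InOD? xs = (All.all? (0 ℕ.<?_) xs ×-dec linked? (λ a b → b ℕ.≤? a) xs)
           ×-dec (All.all? (λ a → a % 2 ≟ 1) xs ×-dec All.all? (λ a → mult a xs ℕ.≤? 1) xs)

InOD⇒InC : ∀ {xs} → InOD xs → InC xs
InOD⇒InC (partition , odd , mults) =
  partition , All.map (λ ≤1 → ℕ.≤-trans ≤1 (s≤s z≤n)) mults , All.map (λ oa → All.map (separated oa) odd) odd
  where
  separated : ∀ {a b} → a % 2 ≡ 1 → b % 2 ≡ 1 → Separated a b
  separated {a} {b} oa ob with ℕ.<-cmp a b
  ... | tri< a<b _ _ = inj₂ (inj₂ (1+<⇒+2≤ (odd-gap oa ob a<b)))
  ... | tri≈ _ a≡b _ = inj₁ a≡b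
  ... | tri> _ _ b<a = inj₂ (inj₁ (1+<⇒+2≤ (odd-gap ob oa b<a)))

InOD⇒ℓr≡0 : ∀ {xs} → InOD xs → ℓr xs ≡ 0
InOD⇒ℓr≡0 {xs} (_ , _ , mults) =
  cong length (List.filter-none (repeated? xs)
                                (All-dedup (All.map (λ ≤1 2≤ → ℕ.<-irrefl refl (ℕ.≤-trans 2≤ ≤1)) mults)))

InOD⇒even : ∀ {xs} → InOD xs → ℓr xs % 2 ≡ 0
InOD⇒even od = cong (_% 2) (InOD⇒ℓr≡0 od)

InOD-tail : ∀ {x r} → InOD (x ∷ r) → InOD r
InOD-tail {x} {r} ((_ ∷ pos , linked) , _ ∷ odd , _ ∷ mults) =
  (pos , linked-tail linked) , odd , All.map (λ {a} → ℕ.≤-trans (mult-tail a x r)) mults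

InOD-head : ∀ {x r} → InOD (x ∷ r) → x % 2 ≡ 1
InOD-head (_ , odd-x ∷ _ , _) = odd-x

InOD-cons : ∀ {x r} → 0 < x → x % 2 ≡ 1 → Above x r → InOD r → InOD (x ∷ r)
InOD-cons {x} {r} pos odd-x above ((pos-r , linked) , odd , mults) =
  (pos ∷ pos-r , linked-cons (Above⇒≤ above) linked) , odd-x ∷ odd ,
  ℕ.≤-reflexive (trans (mult-head x r) (cong suc (mult-above above)))
  ∷ All.zipWith (λ (eq , ≤1) → ℕ.≤-trans (ℕ.≤-reflexive eq) ≤1) (mult-below above , mults)

¬InOD-double : ∀ {x r} → ¬ InOD (x ∷ x ∷ r)
¬InOD-double {x} {r} (_ , _ , ≤1 ∷ _) with subst (_≤ 1) (mult-pair x r) ≤1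
... | s≤s ()

C-partitions : ℕ → ℕ → List (List ℕ)
C-partitions zero M = [ [] ]
C-partitions (suc m) zero = []
C-partitions (suc m) (suc zero) = []
C-partitions (suc m) (suc (suc M)) =
  C-partitions (suc m) (suc M)
  ++ map (suc M ∷_) (C-partitions m M)
  ++ map (λ r → suc M ∷ suc M ∷ r) (C-partitions m M)

Bounded : ℕ → List ℕ → Set
Bounded M xs = All (_< M) xs

CPartition : ℕ → ℕ → List ℕ → Set
CPartition m M xs = IsC xs × ℓd xs ≡ m × Bounded M xs

private
  bounded⇒above : ∀ {M r} → Bounded M r → Above (suc M) r
  bounded⇒above = All.map s≤s

  bounded-suc : ∀ {M r} → Bounded M r → Bounded (suc M) r
  bounded-suc = All.map ℕ.m<n⇒m<1+n

  top-single : ∀ {m M r} → CPartition m M r → CPartition (suc m) (suc (suc M)) (suc M ∷ r)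
  top-single (c , ℓd≡m , bounded) =
    single (s≤s z≤n) (bounded⇒above bounded) c ,
    trans (ℓd-single (Above⇒≢ (bounded⇒above bounded))) (cong suc ℓd≡m) ,
    ℕ.n<1+n _ ∷ bounded-suc (bounded-suc bounded)

  top-double : ∀ {m M r} → CPartition m M r → CPartition (suc m) (suc (suc M)) (suc M ∷ suc M ∷ r)
  top-double (c , ℓd≡m , bounded) =
    double (s≤s z≤n) (bounded⇒above bounded) c ,
    trans (ℓd-double (Above⇒≢ (bounded⇒above bounded))) (cong suc ℓd≡m) ,
    ℕ.n<1+n _ ∷ ℕ.n<1+n _ ∷ bounded-suc (bounded-suc bounded)

C-partitions-sound : ∀ m M → All (CPartition m M) (C-partitions m M)
C-partitions-sound zero M = (empty , refl , []) ∷ []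
C-partitions-sound (suc m) zero = []
C-partitions-sound (suc m) (suc zero) = []
C-partitions-sound (suc m) (suc (suc M)) =
  Allₚ.++⁺ (All.map (λ (c , ℓd≡ , bounded) → c , ℓd≡ , bounded-suc bounded)
                    (C-partitions-sound (suc m) (suc M)))
    (Allₚ.++⁺ (Allₚ.map⁺ (All.map top-single (C-partitions-sound m M)))
             (Allₚ.map⁺ (All.map top-double (C-partitions-sound m M))))

private
  above⇒bounded : ∀ {M r} → Above (suc M) r → Bounded M r
  above⇒bounded = All.map ℕ.≤-pred

  IsC-head : ∀ {x r} → IsC (x ∷ r) → All (_≤ x) r
  IsC-head (single _ above _) = Above⇒≤ above
  IsC-head (double _ above _) = ℕ.≤-refl ∷ Above⇒≤ above

  below-top : ∀ {M x r} → IsC (x ∷ r) → x < suc (suc M) → x ≢ suc M → Bounded (suc M) (x ∷ r)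
  below-top c x<M+2 x≢M+1 = x<M+1 ∷ All.map (λ y≤x → ℕ.≤-<-trans y≤x x<M+1) (IsC-head c)
    where
    x<M+1 = ℕ.≤∧≢⇒< (ℕ.≤-pred x<M+2) x≢M+1

  complete-step : ∀ {m M x r} → IsC (x ∷ r) → ℓd (x ∷ r) ≡ suc m → x < suc (suc M) →
    (Bounded (suc M) (x ∷ r) → (x ∷ r) ∈ C-partitions (suc m) (suc M)) →
    (∀ {ys} → IsC ys → ℓd ys ≡ m → Bounded M ys → ys ∈ C-partitions m M) →
    (x ∷ r) ∈ C-partitions (suc m) (suc (suc M))
  complete-step {M = M} {x} c ℓd≡ x<M+2 lower rest with x ≟ suc M
  complete-step {m} {M} (single _ above c-r) ℓd≡ _ _ rest | yes refl =
    ∈.∈-++⁺ʳ (C-partitions (suc m) (suc M))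
      (∈.∈-++⁺ˡ (∈.∈-map⁺ (suc M ∷_) (rest c-r ℓd-r (above⇒bounded above))))
    where ℓd-r = ℕ.suc-injective (trans (sym (ℓd-single (Above⇒≢ above))) ℓd≡)
  complete-step {m} {M} (double _ above c-r) ℓd≡ _ _ rest | yes refl =
    ∈.∈-++⁺ʳ (C-partitions (suc m) (suc M)) (∈.∈-++⁺ʳ (map (suc M ∷_) (C-partitions m M))
      (∈.∈-map⁺ (λ r → suc M ∷ suc M ∷ r) (rest c-r ℓd-r (above⇒bounded above))))
    where ℓd-r = ℕ.suc-injective (trans (sym (ℓd-double (Above⇒≢ above))) ℓd≡)
  ... | no x≢M+1 = ∈.∈-++⁺ˡ (lower (below-top c x<M+2 x≢M+1))

C-partitions-complete : ∀ m M {xs} → IsC xs → ℓd xs ≡ m → Bounded M xs → xs ∈ C-partitions m M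
C-partitions-complete zero M empty _ _ = here refl
C-partitions-complete (suc m) zero _ _ (() ∷ _)
C-partitions-complete (suc m) (suc zero) (single () _ _) _ (s≤s z≤n ∷ _)
C-partitions-complete (suc m) (suc zero) (double () _ _) _ (s≤s z≤n ∷ _)
C-partitions-complete (suc m) (suc (suc M)) c ℓd≡ (x<M+2 ∷ bounded) =
  complete-step c ℓd≡ x<M+2 (C-partitions-complete (suc m) (suc M) c ℓd≡) (C-partitions-complete m M)

private
  top-unbounded : ∀ {M r} → ¬ Bounded M (M ∷ r)
  top-unbounded (M<M ∷ _) = ℕ.<-irrefl refl M<M

-- The three parts of C-partitions (suc m) (suc (suc M)) are told apart by whether all parts, or
-- all parts but the first, lie below M + 1.
C-partitions-unique : ∀ m M → Unique (C-partitions m M)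
C-partitions-unique zero M = [] ∷ []
C-partitions-unique (suc m) zero = []
C-partitions-unique (suc m) (suc zero) = []
C-partitions-unique (suc m) (suc (suc M)) =
  Unique.++⁺ (C-partitions-unique (suc m) (suc M))
    (Unique.++⁺ (Unique.map⁺ List.∷-injectiveʳ (C-partitions-unique m M))
                (Unique.map⁺ (List.∷-injectiveʳ ∘ List.∷-injectiveʳ) (C-partitions-unique m M))
                (disjoint-by (Bounded (suc M) ∘ drop 1) singles-bounded-below doubles-unbounded-below))
    (disjoint-by (Bounded (suc M)) (All.map (proj₂ ∘ proj₂) (C-partitions-sound (suc m) (suc M)))
       (Allₚ.++⁺ singles-unbounded doubles-unbounded))
  where
  singles = map (suc M ∷_) (C-partitions m M)
  doubles = map (λ r → suc M ∷ suc M ∷ r) (C-partitions m M)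
  singles-unbounded : All (¬_ ∘ Bounded (suc M)) singles
  singles-unbounded = Allₚ.map⁺ (All.tabulate λ _ → top-unbounded)
  doubles-unbounded : All (¬_ ∘ Bounded (suc M)) doubles
  doubles-unbounded = Allₚ.map⁺ (All.tabulate λ _ → top-unbounded)
  singles-bounded-below : All (Bounded (suc M) ∘ drop 1) singles
  singles-bounded-below = Allₚ.map⁺ (All.map (bounded-suc ∘ proj₂ ∘ proj₂) (C-partitions-sound m M))
  doubles-unbounded-below : All (¬_ ∘ Bounded (suc M) ∘ drop 1) doubles
  doubles-unbounded-below = Allₚ.map⁺ (All.tabulate λ _ → top-unbounded)

C-partitions-empty : ∀ m M → M ≤ suc (m + m) → C-partitions (suc m) M ≡ []
C-partitions-empty m zero _ = refl
C-partitions-empty m (suc zero) _ = refl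
C-partitions-empty zero (suc (suc M)) (s≤s ())
C-partitions-empty (suc m) (suc (suc M)) (s≤s (s≤s M≤))
  rewrite C-partitions-empty (suc m) (suc M) (s≤s (ℕ.m≤n⇒m≤1+n M≤))
        | C-partitions-empty m M (ℕ.≤-trans M≤ (ℕ.≤-reflexive (ℕ.+-suc m m))) = refl


-- Generating functions

genSeries : (List ℕ → ℤ) → List (List ℕ) → Series
genSeries w [] = 𝟘
genSeries w (r ∷ L) = q^ size r · scalar (w r) ⊕ genSeries w L

genSeries-++ : ∀ w A B → genSeries w (A ++ B) ≗ genSeries w A ⊕ genSeries w B
genSeries-++ w [] B n = sym (ℤ.+-identityˡ _)
genSeries-++ w (r ∷ A) B n =
  trans (cong₂ ℤ._+_ (refl {x = (q^ size r · scalar (w r)) n}) (genSeries-++ w A B n))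
        (sym (ℤ.+-assoc ((q^ size r · scalar (w r)) n) (genSeries w A n) (genSeries w B n)))

genSeries-map : ∀ {w v} k f L → All (λ r → size (f r) ≡ k + size r × w (f r) ≡ v r) L →
                genSeries w (map f L) ≗ q^ k · genSeries v L
genSeries-map k f [] [] n = sym (q^-𝟘 k n)
genSeries-map {w} {v} k f (r ∷ L) ((size≡ , w≡) ∷ rest) n = begin
  (q^ size (f r) · scalar (w (f r))) n ℤ.+ genSeries w (map f L) n
      ≡⟨ cong₂ ℤ._+_ (trans (cong₂ (λ s c → (q^ s · scalar c) n) size≡ w≡) (q^-+ k (size r) (scalar (v r)) n))
                     (genSeries-map k f L rest n) ⟩
  (q^ k · q^ size r · scalar (v r)) n ℤ.+ (q^ k · genSeries v L) n
      ≡⟨ q^-⊕ k (q^ size r · scalar (v r)) (genSeries v L) n ⟨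
  (q^ k · genSeries v (r ∷ L)) n ∎
  where open ≡-Reasoning

genSeries-neg : ∀ w L → genSeries (λ r → ℤ.- w r) L ≗ ⊝ genSeries w L
genSeries-neg w [] n = refl
genSeries-neg w (r ∷ L) n =
  trans (cong₂ ℤ._+_ (monomial-neg n) (genSeries-neg w L n))
        (sym (ℤ.neg-distrib-+ ((q^ size r · scalar (w r)) n) (genSeries w L n)))
  where
  scalar-neg : scalar (ℤ.- w r) ≗ ⊝ scalar (w r)
  scalar-neg zero = refl
  scalar-neg (suc _) = refl
  monomial-neg : q^ size r · scalar (ℤ.- w r) ≗ ⊝ q^ size r · scalar (w r)
  monomial-neg n = trans (q^-cong (size r) scalar-neg n) (q^-⊝ (size r) (scalar (w r)) n)

genSeries-zero : ∀ {w} L → All (λ r → w r ≡ 0ℤ) L → genSeries w L ≗ 𝟘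
genSeries-zero [] [] n = refl
genSeries-zero {w} (r ∷ L) (w≡0 ∷ rest) n =
  cong₂ ℤ._+_ (trans (q^-cong (size r) scalar-zero n) (q^-𝟘 (size r) n)) (genSeries-zero L rest n)
  where
  scalar-zero : scalar (w r) ≗ 𝟘
  scalar-zero zero = w≡0
  scalar-zero (suc _) = refl

indicator : ∀ {P : Set} → Dec P → ℤ
indicator (yes _) = 1ℤ
indicator (no _) = 0ℤ

indicator-no : ∀ {P : Set} → ¬ P → (p? : Dec P) → indicator p? ≡ 0ℤ
indicator-no ¬p (yes p) = contradiction p ¬p
indicator-no ¬p (no _) = refl

indicator-cong : ∀ {P Q : Set} → (P → Q) → (Q → P) → (p? : Dec P) (q? : Dec Q) →
                 indicator p? ≡ indicator q?
indicator-cong P→Q Q→P (yes _) (yes _) = refl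
indicator-cong P→Q Q→P (yes p) (no ¬q) = contradiction (P→Q p) ¬q
indicator-cong P→Q Q→P (no ¬p) (yes q) = contradiction (Q→P q) ¬p
indicator-cong P→Q Q→P (no _) (no _) = refl

sign : List ℕ → ℤ
sign r = -1ℤ ℤ.^ ℓr r

odWeight : List ℕ → ℤ
odWeight r = indicator (InOD? r)

signedSeries odSeries : ℕ → ℕ → Series
signedSeries m M = genSeries sign (C-partitions m M)
odSeries m M = genSeries odWeight (C-partitions m M)

private
  room-for-top : ∀ m M → All (λ r → Above (suc M) r × All (suc M ≢_) r) (C-partitions m M)
  room-for-top m M =
    All.map (λ (_ , _ , bounded) → bounded⇒above bounded , Above⇒≢ (bounded⇒above bounded)) (C-partitions-sound m M)

signedSeries-step : ∀ m M → signedSeries (suc m) (suc (suc M)) ≗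
  signedSeries (suc m) (suc M) ⊕ q^ suc M · 1-q^ suc M · signedSeries m M
signedSeries-step m M = begin
  genSeries sign (A ++ singles ++ doubles)               ≈⟨ genSeries-++ sign A (singles ++ doubles) ⟩
  genSeries sign A ⊕ genSeries sign (singles ++ doubles) ≈⟨ ⊕-congʳ (genSeries sign A) top-blocks ⟩
  genSeries sign A ⊕ q^ x · 1-q^ x · S                   ∎
  where
  open ≗-Reasoning
  x = suc M
  L = C-partitions m M
  S = signedSeries m M
  A = C-partitions (suc m) (suc M)
  singles = map (x ∷_) L
  doubles = map (λ r → x ∷ x ∷ r) L
  single-weights : All (λ r → size (x ∷ r) ≡ x + size r × sign (x ∷ r) ≡ sign r) L
  single-weights = All.map (λ (_ , x∉r) → refl , cong (-1ℤ ℤ.^_) (ℓr-single x∉r)) (room-for-top m M)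
  double-weights : All (λ r → size (x ∷ x ∷ r) ≡ (x + x) + size r × sign (x ∷ x ∷ r) ≡ ℤ.- sign r) L
  double-weights = All.map (λ {r} (_ , x∉r) → sym (ℕ.+-assoc x x (size r)) ,
                                              trans (cong (-1ℤ ℤ.^_) (ℓr-double x∉r)) (-1^-suc (ℓr r)))
                           (room-for-top m M)
  top-blocks : genSeries sign (singles ++ doubles) ≗ q^ x · 1-q^ x · S
  top-blocks = begin
    genSeries sign (singles ++ doubles)            ≈⟨ genSeries-++ sign singles doubles ⟩
    genSeries sign singles ⊕ genSeries sign doubles
      ≈⟨ ⊕-cong (genSeries-map x (x ∷_) L single-weights)
                (λ n → trans (genSeries-map (x + x) (λ r → x ∷ x ∷ r) L double-weights n)
                             (q^-cong (x + x) (genSeries-neg sign L) n)) ⟩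
    q^ x · S ⊕ q^ (x + x) · ⊝ S
      ≈⟨ ⊕-congʳ (q^ x · S) (λ n → trans (q^-⊝ (x + x) S n) (cong ℤ.-_ (q^-+ x x S n))) ⟩
    q^ x · S ⊖ q^ x · q^ x · S                     ≈⟨ q^-⊖ x S (q^ x · S) ⟨
    q^ x · 1-q^ x · S                              ∎

private
  odSeries-step : ∀ m M → odSeries (suc m) (suc (suc M)) ≗
    odSeries (suc m) (suc M) ⊕ genSeries odWeight (map (suc M ∷_) (C-partitions m M))
  odSeries-step m M = begin
    genSeries odWeight (A ++ singles ++ doubles)                   ≈⟨ genSeries-++ odWeight A (singles ++ doubles) ⟩
    genSeries odWeight A ⊕ genSeries odWeight (singles ++ doubles) ≈⟨ ⊕-congʳ (genSeries odWeight A) top-blocks ⟩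
    genSeries odWeight A ⊕ genSeries odWeight singles              ∎
    where
    open ≗-Reasoning
    x = suc M
    A = C-partitions (suc m) (suc M)
    singles = map (x ∷_) (C-partitions m M)
    doubles = map (λ r → x ∷ x ∷ r) (C-partitions m M)
    doubles-not-OD : All (λ r → odWeight r ≡ 0ℤ) doubles
    doubles-not-OD = Allₚ.map⁺ (All.tabulate λ {r} _ → indicator-no ¬InOD-double (InOD? (x ∷ x ∷ r)))
    top-blocks : genSeries odWeight (singles ++ doubles) ≗ genSeries odWeight singles
    top-blocks n = trans (genSeries-++ odWeight singles doubles n)
                         (trans (⊕-congʳ (genSeries odWeight singles) (genSeries-zero doubles doubles-not-OD) n)
                                (ℤ.+-identityʳ _))

odSeries-odd-top : ∀ m k → odSeries (suc m) (suc (suc (k + k))) ≗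
  odSeries (suc m) (suc (k + k)) ⊕ q^ suc (k + k) · odSeries m (k + k)
odSeries-odd-top m k n =
  trans (odSeries-step m (k + k) n)
        (⊕-congʳ (odSeries (suc m) (suc (k + k))) (genSeries-map x (x ∷_) (C-partitions m (k + k)) weights) n)
  where
  x = suc (k + k)
  weights : All (λ r → size (x ∷ r) ≡ x + size r × odWeight (x ∷ r) ≡ odWeight r) (C-partitions m (k + k))
  weights = All.map (λ {r} (above , _) →
                       refl , indicator-cong InOD-tail (InOD-cons (s≤s z≤n) (odd-double k) above) (InOD? (x ∷ r)) (InOD? r))
                    (room-for-top m (k + k))

odSeries-even-top : ∀ m k → odSeries (suc m) (suc (suc (suc (k + k)))) ≗ odSeries (suc m) (suc (suc (k + k)))
odSeries-even-top m k n =
  trans (odSeries-step m (suc (k + k)) n)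
        (trans (⊕-congʳ (odSeries (suc m) (suc (suc (k + k)))) (genSeries-zero singles not-OD) n)
               (ℤ.+-identityʳ _))
  where
  x = suc (suc (k + k))
  singles = map (x ∷_) (C-partitions m (suc (k + k)))
  not-OD : All (λ r → odWeight r ≡ 0ℤ) singles
  not-OD = Allₚ.map⁺ (All.tabulate λ {r} _ →
             indicator-no (λ od → parity-clash {k + k} (even-double k) (InOD-head od)) (InOD? (x ∷ r)))

private
  signedSeries-≡ : ∀ m {M M′} → M ≡ M′ → signedSeries m M ≗ signedSeries m M′
  signedSeries-≡ m refl _ = refl

  odSeries-≡ : ∀ m {M M′} → M ≡ M′ → odSeries m M ≗ odSeries m M′
  odSeries-≡ m refl _ = refl

  empty-series : ∀ w m → genSeries w (C-partitions (suc m) (suc (m + m))) ≗ 𝟘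
  empty-series w m n = cong (λ L → genSeries w L n) (C-partitions-empty m (suc (m + m)) ℕ.≤-refl)

  two-more : ∀ t m → suc t + (suc m + suc m) ≡ suc (suc (suc t + (m + m)))
  two-more = ℕ-Ring.solve-∀

  one-more : ∀ t m → t + (suc m + suc m) ≡ suc (suc t + (m + m))
  one-more = ℕ-Ring.solve-∀

signedSeries-closed : ∀ m t → signedSeries m (t + (m + m)) ≗ signedClosed m t
signedSeries-closed zero t n = ℤ.+-identityʳ _
signedSeries-closed (suc m) zero = begin
  signedSeries (suc m) (suc m + suc m)                  ≈⟨ signedSeries-≡ (suc m) (cong suc (ℕ.+-suc m m)) ⟩
  signedSeries (suc m) (suc K)                          ≈⟨ signedSeries-step m (m + m) ⟩
  signedSeries (suc m) K ⊕ q^ K · 1-q^ K · signedSeries m (m + m)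
      ≈⟨ ⊕-cong (empty-series sign m) (q^-cong K (1-q^-cong K (signedSeries-closed m zero))) ⟩
  𝟘 ⊕ q^ K · 1-q^ K · signedClosed m 0                 ≈⟨ (λ n → ℤ.+-identityˡ _) ⟩
  q^ K · 1-q^ K · signedClosed m 0                      ≈⟨ signedClosed-zero m ⟨
  signedClosed (suc m) 0                                ∎
  where
  open ≗-Reasoning
  K = suc (m + m)
signedSeries-closed (suc m) (suc t) = begin
  signedSeries (suc m) (suc t + (suc m + suc m))        ≈⟨ signedSeries-≡ (suc m) (two-more t m) ⟩
  signedSeries (suc m) (suc E)                          ≈⟨ signedSeries-step m (suc t + (m + m)) ⟩
  signedSeries (suc m) E ⊕ q^ E · 1-q^ E · signedSeries m (suc t + (m + m))
      ≈⟨ ⊕-cong (λ n → trans (signedSeries-≡ (suc m) (sym (one-more t m)) n)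
                             (signedSeries-closed (suc m) t n))
                (q^-cong E (1-q^-cong E (signedSeries-closed m (suc t)))) ⟩
  signedClosed (suc m) t ⊕ q^ E · 1-q^ E · signedClosed m (suc t) ≈⟨ signedClosed-suc m t ⟨
  signedClosed (suc m) (suc t)                          ∎
  where
  open ≗-Reasoning
  E = suc (suc t + (m + m))

private
  double-suc : ∀ m → suc m + suc m ≡ suc (suc (m + m))
  double-suc m = cong suc (ℕ.+-suc m m)

  double-shift : ∀ s m → (s + suc m) + (s + suc m) ≡ suc (suc ((s + m) + (s + m)))
  double-shift = ℕ-Ring.solve-∀

odSeries-closed : ∀ m s → odSeries m ((s + m) + (s + m)) ≗ odClosed m s
odSeries-closed zero s n = ℤ.+-identityʳ _
odSeries-closed (suc m) zero = begin
  odSeries (suc m) (suc m + suc m)                      ≈⟨ odSeries-≡ (suc m) (double-suc m) ⟩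
  odSeries (suc m) (suc K)                              ≈⟨ odSeries-odd-top m m ⟩
  odSeries (suc m) K ⊕ q^ K · odSeries m (m + m)
      ≈⟨ ⊕-cong (empty-series odWeight m) (q^-cong K (odSeries-closed m zero)) ⟩
  𝟘 ⊕ q^ K · odClosed m 0                              ≈⟨ (λ n → ℤ.+-identityˡ _) ⟩
  q^ K · odClosed m 0                                   ≈⟨ odClosed-zero m ⟨
  odClosed (suc m) 0                                    ∎
  where
  open ≗-Reasoning
  K = suc (m + m)
odSeries-closed (suc m) (suc s) = begin
  odSeries (suc m) (k + k)                              ≈⟨ odSeries-≡ (suc m) (double-shift (suc s) m) ⟩
  odSeries (suc m) (suc (suc (j + j)))                  ≈⟨ odSeries-odd-top m j ⟩
  odSeries (suc m) (suc (j + j)) ⊕ q^ suc (j + j) · odSeries m (j + j)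
      ≈⟨ ⊕-cong (λ n → trans (odSeries-≡ (suc m) (cong suc (double-suc (s + m))) n)
                         (trans (odSeries-even-top m (s + m) n)
                         (trans (odSeries-≡ (suc m) (sym (double-shift s m)) n) (odSeries-closed (suc m) s n))))
                (q^-cong (suc (j + j)) (odSeries-closed m (suc s))) ⟩
  odClosed (suc m) s ⊕ q^ suc (j + j) · odClosed m (suc s) ≈⟨ odClosed-suc m s ⟨
  odClosed (suc m) (suc s)                              ∎
  where
  open ≗-Reasoning
  k = suc s + suc m
  j = suc s + m

signed≡od-coefficient : ∀ m s {n} → n ≤ s →
                        signedSeries m ((s + m) + (s + m)) n ≡ odSeries m ((s + m) + (s + m)) n
signed≡od-coefficient m s {n} n≤s = begin
  signedSeries m ((s + m) + (s + m)) n        ≡⟨ signedSeries-≡ m (regroup s m) n ⟩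
  signedSeries m ((s + s) + (m + m)) n        ≡⟨ signedSeries-closed m (s + s) n ⟩
  signedClosed m (s + s) n                    ≡⟨ q^-mod (m * m) (oddPochhammer-gauss m {s} (ℕ.n≤1+n (s + s))) n<bound ⟩
  odClosed m s n                              ≡⟨ odSeries-closed m s n ⟨
  odSeries m ((s + m) + (s + m)) n            ∎
  where
  open ≡-Reasoning
  regroup : ∀ s m → (s + m) + (s + m) ≡ (s + s) + (m + m)
  regroup = ℕ-Ring.solve-∀
  n<bound : n < m * m + suc (s + s)
  n<bound = ℕ.≤-trans (s≤s (ℕ.≤-trans n≤s (ℕ.m≤m+n s s))) (ℕ.m≤n+m _ (m * m))

ofSize : ℕ → List (List ℕ) → List (List ℕ)
ofSize n = filter (λ r → size r ≟ n)

private
  monomial-at : ∀ r {n} c → size r ≡ n → (q^ size r · scalar c) n ≡ c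
  monomial-at r c refl = q^-scalar-at (size r) c

  monomial-off : ∀ r {n} c → size r ≢ n → (q^ size r · scalar c) n ≡ 0ℤ
  monomial-off r c = q^-scalar-off (size r) c

genSeries-coefficient : ∀ w (count : List (List ℕ) → ℤ) → count [] ≡ 0ℤ →
  (∀ r K → count (r ∷ K) ≡ w r ℤ.+ count K) → ∀ n L → genSeries w L n ≡ count (ofSize n L)
genSeries-coefficient w count count-[] count-∷ n [] = sym count-[]
genSeries-coefficient w count count-[] count-∷ n (r ∷ L) = by-size (size r ≟ n)
  where
  open ≡-Reasoning
  IH = genSeries-coefficient w count count-[] count-∷ n L
  by-size : Dec (size r ≡ n) → genSeries w (r ∷ L) n ≡ count (ofSize n (r ∷ L))
  by-size (yes size≡n) = begin
    (q^ size r · scalar (w r)) n ℤ.+ genSeries w L n ≡⟨ cong₂ ℤ._+_ (monomial-at r (w r) size≡n) IH ⟩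
    w r ℤ.+ count (ofSize n L)                       ≡⟨ count-∷ r (ofSize n L) ⟨
    count (r ∷ ofSize n L)                           ≡⟨ cong count (List.filter-accept (λ r → size r ≟ n) {r} {L} size≡n) ⟨
    count (ofSize n (r ∷ L))                         ∎
  by-size (no size≢n) = begin
    (q^ size r · scalar (w r)) n ℤ.+ genSeries w L n ≡⟨ cong₂ ℤ._+_ (monomial-off r (w r) size≢n) IH ⟩
    0ℤ ℤ.+ count (ofSize n L)                        ≡⟨ ℤ.+-identityˡ _ ⟩
    count (ofSize n L)                               ≡⟨ cong count (List.filter-reject (λ r → size r ≟ n) {r} {L} size≢n) ⟨
    count (ofSize n (r ∷ L))                         ∎

evenℓr? : Decidable (λ r → ℓr r % 2 ≡ 0)
evenℓr? r = ℓr r % 2 ≟ 0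

oddℓr? : Decidable (λ r → ℓr r % 2 ≡ 1)
oddℓr? r = ℓr r % 2 ≟ 1

signedCount : List (List ℕ) → ℤ
signedCount K = + length (filter evenℓr? K) ℤ.- + length (filter oddℓr? K)

odCount : List (List ℕ) → ℤ
odCount K = + length (filter InOD? K)

signedCount-∷ : ∀ r K → signedCount (r ∷ K) ≡ sign r ℤ.+ signedCount K
signedCount-∷ r K = by-parity (%2-cases (ℓr r))
  where
  open ≡-Reasoning
  a = + length (filter evenℓr? K)
  b = + length (filter oddℓr? K)
  count-up : ∀ a b → (1ℤ ℤ.+ a) ℤ.- b ≡ 1ℤ ℤ.+ (a ℤ.- b)
  count-up = solve-∀
  count-down : ∀ a b → a ℤ.- (1ℤ ℤ.+ b) ≡ -1ℤ ℤ.+ (a ℤ.- b)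
  count-down = solve-∀
  by-parity : ℓr r % 2 ≡ 0 ⊎ ℓr r % 2 ≡ 1 → signedCount (r ∷ K) ≡ sign r ℤ.+ signedCount K
  by-parity (inj₁ even) = begin
    signedCount (r ∷ K)         ≡⟨ cong₂ (λ A B → + length A ℤ.- + length B) (List.filter-accept evenℓr? {r} {K} even)
                                         (List.filter-reject oddℓr? {r} {K} (parity-clash {ℓr r} even)) ⟩
    (1ℤ ℤ.+ a) ℤ.- b            ≡⟨ count-up a b ⟩
    1ℤ ℤ.+ (a ℤ.- b)            ≡⟨ cong (ℤ._+ (a ℤ.- b)) (-1^-even {ℓr r} even) ⟨
    sign r ℤ.+ signedCount K    ∎
  by-parity (inj₂ odd) = begin
    signedCount (r ∷ K)         ≡⟨ cong₂ (λ A B → + length A ℤ.- + length B)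
                                         (List.filter-reject evenℓr? {r} {K} (λ even → parity-clash {ℓr r} even odd))
                                         (List.filter-accept oddℓr? {r} {K} odd) ⟩
    a ℤ.- (1ℤ ℤ.+ b)            ≡⟨ count-down a b ⟩
    -1ℤ ℤ.+ (a ℤ.- b)           ≡⟨ cong (ℤ._+ (a ℤ.- b)) (-1^-odd {ℓr r} odd) ⟨
    sign r ℤ.+ signedCount K    ∎

odCount-∷ : ∀ r K → odCount (r ∷ K) ≡ odWeight r ℤ.+ odCount K
odCount-∷ r K = by-OD (InOD? r)
  where
  by-OD : (od? : Dec (InOD r)) → odCount (r ∷ K) ≡ indicator od? ℤ.+ odCount K
  by-OD (yes od) = cong (+_ ∘ length) (List.filter-accept InOD? {r} {K} od)
  by-OD (no ¬od) = trans (cong (+_ ∘ length) (List.filter-reject InOD? {r} {K} ¬od)) (sym (ℤ.+-identityˡ _))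

-- Swapping two equinumerous lists

module Swapping {A : Set} (_≟_ : DecidableEquality A) where

  open import Data.List.Membership.DecPropositional _≟_ using (_∈?_)

  private
    ∈-lookup : ∀ {xs : List A} i → lookup xs i ∈ xs
    ∈-lookup = ∈.∈-lookup

    index-∈-lookup : ∀ xs (i : Fin (length xs)) → index (∈-lookup {xs} i) ≡ i
    index-∈-lookup (x ∷ xs) Fin.zero = refl
    index-∈-lookup (x ∷ xs) (Fin.suc i) = cong Fin.suc (index-∈-lookup xs i)

    ∈-irrelevant : ∀ {xs} → Unique xs → ∀ {x} (p q : x ∈ xs) → p ≡ q
    ∈-irrelevant = ∈ₛ.unique⇒irrelevant (setoid A) (UIP.Decidable⇒UIP.≡-irrelevant _≟_)

  -- The membership decisions are arguments, so that transfer and swap unfold on the same decision.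
  transfer-at : (xs ys : List A) → .(length xs ≡ length ys) → ∀ {x} → Dec (x ∈ xs) → A
  transfer-at xs ys eq (yes x∈xs) = lookup ys (Fin.cast eq (index x∈xs))
  transfer-at xs ys eq {x} (no _) = x

  transfer : (xs ys : List A) → .(length xs ≡ length ys) → A → A
  transfer xs ys eq x = transfer-at xs ys eq (x ∈? xs)

  transfer-∈ : ∀ {xs ys x} .(eq : length xs ≡ length ys) → x ∈ xs → transfer xs ys eq x ∈ ys
  transfer-∈ {xs} {ys} {x} eq x∈xs with x ∈? xs
  ... | yes p = ∈-lookup (Fin.cast eq (index p))
  ... | no x∉xs = contradiction x∈xs x∉xs

  transfer-lookup : ∀ {xs ys} .(eq : length xs ≡ length ys) → Unique xs →
                    ∀ i → transfer xs ys eq (lookup xs i) ≡ lookup ys (Fin.cast eq i)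
  transfer-lookup {xs} {ys} eq unique i with lookup xs i ∈? xs
  ... | yes p = cong (lookup ys ∘ Fin.cast eq)
                     (trans (cong index (∈-irrelevant unique p (∈-lookup i))) (index-∈-lookup xs i))
  ... | no ∉xs = contradiction (∈-lookup i) ∉xs

  transfer-inverse : ∀ {xs ys x} .(eq : length xs ≡ length ys) → Unique xs → Unique ys → x ∈ xs →
                     transfer ys xs (sym eq) (transfer xs ys eq x) ≡ x
  transfer-inverse {xs} {ys} {x} eq unique-xs unique-ys x∈xs = begin
    transfer ys xs (sym eq) (transfer xs ys eq x)
      ≡⟨ cong (transfer ys xs (sym eq) ∘ transfer xs ys eq) (lookup-index x∈xs) ⟩
    transfer ys xs (sym eq) (transfer xs ys eq (lookup xs i))
      ≡⟨ cong (transfer ys xs (sym eq)) (transfer-lookup eq unique-xs i) ⟩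
    transfer ys xs (sym eq) (lookup ys (Fin.cast eq i))
      ≡⟨ transfer-lookup (sym eq) unique-ys (Fin.cast eq i) ⟩
    lookup xs (Fin.cast (sym eq) (Fin.cast eq i))
      ≡⟨ cong (lookup xs) (Fin.cast-involutive (sym eq) eq i) ⟩
    lookup xs i
      ≡⟨ lookup-index x∈xs ⟨
    x ∎
    where
    open ≡-Reasoning
    i = index x∈xs

  swap-at : (xs ys : List A) → .(length xs ≡ length ys) → ∀ {a} → Dec (a ∈ xs) → Dec (a ∈ ys) → A
  swap-at xs ys eq a∈?xs@(yes _) _ = transfer-at xs ys eq a∈?xs
  swap-at xs ys eq (no _) a∈?ys@(yes _) = transfer-at ys xs (sym eq) a∈?ys
  swap-at xs ys eq {a} (no _) (no _) = a

  swap : (xs ys : List A) → .(length xs ≡ length ys) → A → A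
  swap xs ys eq a = swap-at xs ys eq (a ∈? xs) (a ∈? ys)

  module _ {xs ys : List A} .(eq : length xs ≡ length ys) where

    swap-left : ∀ {a} → a ∈ xs → swap xs ys eq a ≡ transfer xs ys eq a
    swap-left {a} a∈xs with a ∈? xs
    ... | yes _ = refl
    ... | no a∉xs = contradiction a∈xs a∉xs

    swap-right : ∀ {a} → a ∉ xs → a ∈ ys → swap xs ys eq a ≡ transfer ys xs (sym eq) a
    swap-right {a} a∉xs a∈ys with a ∈? xs | a ∈? ys
    ... | yes a∈xs | _ = contradiction a∈xs a∉xs
    ... | no _ | yes _ = refl
    ... | no _ | no a∉ys = contradiction a∈ys a∉ys

    swap-outside : ∀ {a} → a ∉ xs → a ∉ ys → swap xs ys eq a ≡ a
    swap-outside {a} a∉xs a∉ys with a ∈? xs | a ∈? ys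
    ... | yes a∈xs | _ = contradiction a∈xs a∉xs
    ... | no _ | yes a∈ys = contradiction a∈ys a∉ys
    ... | no _ | no _ = refl

    swap-∈ˡ : ∀ {a} → a ∈ xs → swap xs ys eq a ∈ ys
    swap-∈ˡ a∈xs = subst (_∈ ys) (sym (swap-left a∈xs)) (transfer-∈ eq a∈xs)

    swap-∈ʳ : ∀ {a} → Disjoint xs ys → a ∈ ys → swap xs ys eq a ∈ xs
    swap-∈ʳ disjoint a∈ys =
      subst (_∈ xs) (sym (swap-right (λ a∈xs → disjoint (a∈xs , a∈ys)) a∈ys)) (transfer-∈ (sym eq) a∈ys)

    swap-involutive : Unique xs → Unique ys → Disjoint xs ys → ∀ a → swap xs ys eq (swap xs ys eq a) ≡ a
    swap-involutive unique-xs unique-ys disjoint a = by-cases (a ∈? xs) (a ∈? ys)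
      where
      by-cases : Dec (a ∈ xs) → Dec (a ∈ ys) → swap xs ys eq (swap xs ys eq a) ≡ a
      by-cases (yes a∈xs) _ = begin
        swap xs ys eq (swap xs ys eq a)                ≡⟨ cong (swap xs ys eq) (swap-left a∈xs) ⟩
        swap xs ys eq (transfer xs ys eq a)            ≡⟨ swap-right (λ b∈xs → disjoint (b∈xs , b∈ys)) b∈ys ⟩
        transfer ys xs (sym eq) (transfer xs ys eq a)  ≡⟨ transfer-inverse eq unique-xs unique-ys a∈xs ⟩
        a                                              ∎
        where
        open ≡-Reasoning
        b∈ys = transfer-∈ eq a∈xs
      by-cases (no a∉xs) (yes a∈ys) = begin
        swap xs ys eq (swap xs ys eq a)                ≡⟨ cong (swap xs ys eq) (swap-right a∉xs a∈ys) ⟩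
        swap xs ys eq (transfer ys xs (sym eq) a)      ≡⟨ swap-left (transfer-∈ (sym eq) a∈ys) ⟩
        transfer xs ys eq (transfer ys xs (sym eq) a)  ≡⟨ transfer-inverse (sym eq) unique-ys unique-xs a∈ys ⟩
        a                                              ∎
        where open ≡-Reasoning
      by-cases (no a∉xs) (no a∉ys) =
        trans (cong (swap xs ys eq) (swap-outside a∉xs a∉ys)) (swap-outside a∉xs a∉ys)

  module ByKey {K : Set} (key : A → K) (X Y : K → List A)
               (X-key : ∀ {k a} → a ∈ X k → key a ≡ k) (Y-key : ∀ {k a} → a ∈ Y k → key a ≡ k)
               (unique-X : ∀ k → Unique (X k)) (unique-Y : ∀ k → Unique (Y k))
               (disjoint : ∀ k → Disjoint (X k) (Y k)) (same-length : ∀ k → length (X k) ≡ length (Y k)) where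

    swapAt : K → A → A
    swapAt k = swap (X k) (Y k) (same-length k)

    swapByKey : A → A
    swapByKey a = swapAt (key a) a

    swapByKey-X : ∀ {a} → a ∈ X (key a) → swapByKey a ∈ Y (key a)
    swapByKey-X = swap-∈ˡ _

    swapByKey-Y : ∀ {a} → a ∈ Y (key a) → swapByKey a ∈ X (key a)
    swapByKey-Y = swap-∈ʳ _ (disjoint _)

    swapByKey-outside : ∀ {a} → a ∉ X (key a) → a ∉ Y (key a) → swapByKey a ≡ a
    swapByKey-outside = swap-outside _

    swapByKey-key : ∀ a → key (swapByKey a) ≡ key a
    swapByKey-key a = by-cases (a ∈? X (key a)) (a ∈? Y (key a))
      where
      by-cases : Dec (a ∈ X (key a)) → Dec (a ∈ Y (key a)) → key (swapByKey a) ≡ key a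
      by-cases (yes a∈X) _ = Y-key (swapByKey-X a∈X)
      by-cases (no _) (yes a∈Y) = X-key (swapByKey-Y a∈Y)
      by-cases (no a∉X) (no a∉Y) = cong key (swapByKey-outside a∉X a∉Y)

    swapByKey-involutive : ∀ a → swapByKey (swapByKey a) ≡ a
    swapByKey-involutive a =
      trans (cong (λ k → swapAt k (swapByKey a)) (swapByKey-key a))
            (swap-involutive (same-length (key a)) (unique-X (key a)) (unique-Y (key a)) (disjoint (key a)) a)


-- The counting identity

Enumerates-filter : ∀ {P Q : List ℕ → Set} {L} (Q? : Decidable Q) →
                    Enumerates P L → Enumerates (λ xs → P xs × Q xs) (filter Q? L)
Enumerates-filter Q? (unique , members) =
  Unique.filter⁺ Q? unique ,
  λ ys → mk⇔ (λ ∈filter → let (∈L , q) = ∈.∈-filter⁻ Q? ∈filter in Equivalence.to (members ys) ∈L , q)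
             (λ (p , q) → ∈.∈-filter⁺ Q? (Equivalence.from (members ys) p) q)

Enumerates-cong : ∀ {P Q : List ℕ → Set} {L} → (∀ ys → P ys → Q ys) → (∀ ys → Q ys → P ys) →
                  Enumerates P L → Enumerates Q L
Enumerates-cong P⇒Q Q⇒P (unique , members) =
  unique , λ ys → mk⇔ (P⇒Q ys ∘ Equivalence.to (members ys)) (Equivalence.from (members ys) ∘ Q⇒P ys)

parts≤size : ∀ xs → All (_≤ size xs) xs
parts≤size [] = []
parts≤size (x ∷ xs) =
  ℕ.m≤m+n x (size xs) ∷ All.map (λ y≤ → ℕ.≤-trans y≤ (ℕ.m≤n+m (size xs) x)) (parts≤size xs)

-- Every part of a partition of n lies below this bound, which has the form signed≡od-coefficient needs.
partBound : ℕ → ℕ → ℕ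
partBound m n = (suc n + m) + (suc n + m)

C[_,_] : ℕ → ℕ → List (List ℕ)
C[ m , n ] = ofSize n (C-partitions m (partBound m n))

C-enumerates : ∀ m n → Enumerates (InCmn m n) C[ m , n ]
C-enumerates m n =
  Unique.filter⁺ (λ r → size r ≟ n) (C-partitions-unique m B) , λ ys → mk⇔ (to ys) (from ys)
  where
  B = partBound m n
  to : ∀ ys → ys ∈ C[ m , n ] → InCmn m n ys
  to ys ∈C with ∈.∈-filter⁻ (λ r → size r ≟ n) ∈C
  ... | ∈all , size≡n with All.lookup (C-partitions-sound m B) ∈all
  ...   | c , ℓd≡m , _ = IsC⇒InC c , size≡n , ℓd≡m
  from : ∀ ys → InCmn m n ys → ys ∈ C[ m , n ]
  from ys (c , refl , ℓd≡m) =
    ∈.∈-filter⁺ (λ r → size r ≟ n) (C-partitions-complete m B (InC⇒IsC ys c) ℓd≡m bounded) refl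
    where
    bounded : Bounded B ys
    bounded = All.map (λ x≤n → ℕ.≤-trans (s≤s x≤n) (ℕ.≤-trans (ℕ.m≤m+n (suc n) m) (ℕ.m≤m+n (suc n + m) _)))
                      (parts≤size ys)

E[_,_] O[_,_] D[_,_] : ℕ → ℕ → List (List ℕ)
E[ m , n ] = filter evenℓr? C[ m , n ]
O[ m , n ] = filter oddℓr? C[ m , n ]
D[ m , n ] = filter InOD? C[ m , n ]

E-enumerates : ∀ m n → Enumerates (λ xs → InCmn m n xs × ℓr xs % 2 ≡ 0) E[ m , n ]
E-enumerates m n = Enumerates-filter evenℓr? (C-enumerates m n)

O-enumerates : ∀ m n → Enumerates (λ xs → InCmn m n xs × ℓr xs % 2 ≡ 1) O[ m , n ]
O-enumerates m n = Enumerates-filter oddℓr? (C-enumerates m n)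

D-enumerates : ∀ m n → Enumerates (InODmn m n) D[ m , n ]
D-enumerates m n = Enumerates-cong (λ _ ((c , size≡ , ℓd≡) , od) → od , size≡ , ℓd≡)
                                   (λ _ (od , size≡ , ℓd≡) → (InOD⇒InC od , size≡ , ℓd≡) , od)
                                   (Enumerates-filter InOD? (C-enumerates m n))

private
  move-right : ∀ a b c → a ℤ.- b ≡ c → a ≡ b ℤ.+ c
  move-right a b c a-b≡c = trans (restore a b) (cong₂ ℤ._+_ (refl {x = b}) a-b≡c)
    where
    restore : ∀ a b → a ≡ b ℤ.+ (a ℤ.- b)
    restore = solve-∀

count-identity : ∀ m n → length E[ m , n ] ≡ length O[ m , n ] + length D[ m , n ]
count-identity m n =
  ℤ.+-injective (move-right (+ length E[ m , n ]) (+ length O[ m , n ]) (+ length D[ m , n ]) signed)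
  where
  open ≡-Reasoning
  L = C-partitions m (partBound m n)
  signed : signedCount C[ m , n ] ≡ odCount C[ m , n ]
  signed = begin
    signedCount C[ m , n ]              ≡⟨ genSeries-coefficient sign signedCount refl signedCount-∷ n L ⟨
    signedSeries m (partBound m n) n    ≡⟨ signed≡od-coefficient m (suc n) (ℕ.n≤1+n n) ⟩
    odSeries m (partBound m n) n        ≡⟨ genSeries-coefficient odWeight odCount refl odCount-∷ n L ⟩
    odCount C[ m , n ]                  ∎

-- The involution

key : List ℕ → ℕ × ℕ
key xs = ℓd xs , size xs

evenNonOD oddC : ℕ × ℕ → List (List ℕ)
evenNonOD (m , n) = filter (¬? ∘ InOD?) E[ m , n ]
oddC (m , n) = O[ m , n ]

private
  EvenNonOD OddC : ℕ × ℕ → List ℕ → Set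
  EvenNonOD (m , n) xs = (InCmn m n xs × ℓr xs % 2 ≡ 0) × ¬ InOD xs
  OddC (m , n) xs = InCmn m n xs × ℓr xs % 2 ≡ 1

  evenNonOD-enumerates : ∀ k → Enumerates (EvenNonOD k) (evenNonOD k)
  evenNonOD-enumerates (m , n) = Enumerates-filter (¬? ∘ InOD?) (E-enumerates m n)

  oddC-enumerates : ∀ k → Enumerates (OddC k) (oddC k)
  oddC-enumerates (m , n) = O-enumerates m n

  ∈evenNonOD : ∀ {k xs} → xs ∈ evenNonOD k ⇔ EvenNonOD k xs
  ∈evenNonOD {k} {xs} = proj₂ (evenNonOD-enumerates k) xs

  ∈oddC : ∀ {k xs} → xs ∈ oddC k ⇔ OddC k xs
  ∈oddC {k} {xs} = proj₂ (oddC-enumerates k) xs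

  InCmn⇒key : ∀ {m n xs} → InCmn m n xs → key xs ≡ (m , n)
  InCmn⇒key (_ , size≡n , ℓd≡m) = cong₂ _,_ ℓd≡m size≡n

  evenNonOD-key : ∀ {k xs} → xs ∈ evenNonOD k → key xs ≡ k
  evenNonOD-key {m , n} ∈X = InCmn⇒key (proj₁ (proj₁ (Equivalence.to (∈evenNonOD {m , n}) ∈X)))

  oddC-key : ∀ {k xs} → xs ∈ oddC k → key xs ≡ k
  oddC-key {m , n} ∈Y = InCmn⇒key (proj₁ (Equivalence.to (∈oddC {m , n}) ∈Y))

  evenNonOD-oddC-disjoint : ∀ k → Disjoint (evenNonOD k) (oddC k)
  evenNonOD-oddC-disjoint k {xs} (∈X , ∈Y) =
    parity-clash {ℓr xs} (proj₂ (proj₁ (Equivalence.to (∈evenNonOD {k}) ∈X)))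
                         (proj₂ (Equivalence.to (∈oddC {k}) ∈Y))

  evenNonOD-length : ∀ k → length (evenNonOD k) ≡ length (oddC k)
  evenNonOD-length (m , n) = ℕ.+-cancelˡ-≡ (length D[ m , n ]) _ _ (begin
    length D[ m , n ] + length X                  ≡⟨ cong (λ D → length D + length X) OD-in-E ⟨
    length (filter InOD? E[ m , n ]) + length X   ≡⟨ length-filter-split InOD? E[ m , n ] ⟨
    length E[ m , n ]                             ≡⟨ count-identity m n ⟩
    length O[ m , n ] + length D[ m , n ]         ≡⟨ ℕ.+-comm (length O[ m , n ]) _ ⟩
    length D[ m , n ] + length O[ m , n ]         ∎)
    where
    open ≡-Reasoning
    X = evenNonOD (m , n)
    OD-in-E : filter InOD? E[ m , n ] ≡ D[ m , n ]
    OD-in-E = filter-absorb InOD? evenℓr? InOD⇒even C[ m , n ]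

open Swapping (List.≡-dec _≟_) using (module ByKey)
open ByKey key evenNonOD oddC evenNonOD-key oddC-key
           (proj₁ ∘ evenNonOD-enumerates) (proj₁ ∘ oddC-enumerates) evenNonOD-oddC-disjoint evenNonOD-length

ψ : List ℕ → List ℕ
ψ = swapByKey

ψ-involutive : ∀ xs → ψ (ψ xs) ≡ xs
ψ-involutive = swapByKey-involutive

private
  classify : ∀ {xs} → InC xs → InOD xs ⊎ (xs ∈ evenNonOD (key xs) ⊎ xs ∈ oddC (key xs))
  classify {xs} c with InOD? xs | %2-cases (ℓr xs)
  ... | yes od | _ = inj₁ od
  ... | no ¬od | inj₁ even = inj₂ (inj₁ (Equivalence.from ∈evenNonOD (((c , refl , refl) , even) , ¬od)))
  ... | no ¬od | inj₂ odd = inj₂ (inj₂ (Equivalence.from ∈oddC ((c , refl , refl) , odd)))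

  OD-fixed : ∀ {xs} → InOD xs → ψ xs ≡ xs
  OD-fixed {xs} od =
    swapByKey-outside (λ ∈X → proj₂ (Equivalence.to (∈evenNonOD {key xs}) ∈X) od)
                      (λ ∈Y → parity-clash {ℓr xs} (InOD⇒even od) (proj₂ (Equivalence.to (∈oddC {key xs}) ∈Y)))

ψ-InC : ∀ {xs} → InC xs → InC (ψ xs)
ψ-InC {xs} c = by-class (classify c)
  where
  by-class : InOD xs ⊎ (xs ∈ evenNonOD (key xs) ⊎ xs ∈ oddC (key xs)) → InC (ψ xs)
  by-class (inj₁ od) = subst InC (sym (OD-fixed od)) c
  by-class (inj₂ (inj₁ ∈X)) = proj₁ (proj₁ (Equivalence.to (∈oddC {key xs}) (swapByKey-X ∈X)))
  by-class (inj₂ (inj₂ ∈Y)) = proj₁ (proj₁ (proj₁ (Equivalence.to (∈evenNonOD {key xs}) (swapByKey-Y ∈Y))))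

ψ-fixed⇔InOD : ∀ {xs} → InC xs → (ψ xs ≡ xs) ⇔ InOD xs
ψ-fixed⇔InOD {xs} c = mk⇔ (by-class (classify c)) OD-fixed
  where
  disjoint = evenNonOD-oddC-disjoint (key xs)
  by-class : InOD xs ⊎ (xs ∈ evenNonOD (key xs) ⊎ xs ∈ oddC (key xs)) → ψ xs ≡ xs → InOD xs
  by-class (inj₁ od) _ = od
  by-class (inj₂ (inj₁ ∈X)) fixed =
    contradiction (∈X , subst (_∈ oddC (key xs)) fixed (swapByKey-X ∈X)) disjoint
  by-class (inj₂ (inj₂ ∈Y)) fixed =
    contradiction (subst (_∈ evenNonOD (key xs)) fixed (swapByKey-Y ∈Y) , ∈Y) disjoint

ψ-moves : ∀ {xs} → InC xs → ¬ InOD xs →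
  size xs ≡ size (ψ xs) × ℓd xs ≡ ℓd (ψ xs) × ℓr xs % 2 ≢ ℓr (ψ xs) % 2
ψ-moves {xs} c ¬od = by-class (classify c)
  where
  Moved : Set
  Moved = size xs ≡ size (ψ xs) × ℓd xs ≡ ℓd (ψ xs) × ℓr xs % 2 ≢ ℓr (ψ xs) % 2
  even→odd : EvenNonOD (key xs) xs → OddC (key xs) (ψ xs) → Moved
  even→odd ((_ , even) , _) ((_ , size≡ , ℓd≡) , odd) =
    sym size≡ , sym ℓd≡ , λ same → parity-clash {ℓr xs} even (trans same odd)
  odd→even : OddC (key xs) xs → EvenNonOD (key xs) (ψ xs) → Moved
  odd→even (_ , odd) (((_ , size≡ , ℓd≡) , even) , _) =
    sym size≡ , sym ℓd≡ , λ same → parity-clash {ℓr xs} (trans same even) odd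
  by-class : InOD xs ⊎ (xs ∈ evenNonOD (key xs) ⊎ xs ∈ oddC (key xs)) → Moved
  by-class (inj₁ od) = contradiction od ¬od
  by-class (inj₂ (inj₁ ∈X)) = even→odd (Equivalence.to ∈evenNonOD ∈X) (Equivalence.to ∈oddC (swapByKey-X ∈X))
  by-class (inj₂ (inj₂ ∈Y)) = odd→even (Equivalence.to ∈oddC ∈Y) (Equivalence.to ∈evenNonOD (swapByKey-Y ∈Y))

theorem3p3 :
    Σ (List ℕ → List ℕ) (λ ψ →
        (∀ xs → InC xs → InC (ψ xs))
      × (∀ xs → InC xs → ψ (ψ xs) ≡ xs)
      × (∀ xs → InC xs → (ψ xs ≡ xs) ⇔ InOD xs)
      × (∀ xs → InC xs → ¬ InOD xs →
            size xs ≡ size (ψ xs) × ℓd xs ≡ ℓd (ψ xs) × ℓr xs % 2 ≢ ℓr (ψ xs) % 2))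
    × (∀ m n → m ≤ n →
        Σ (List (List ℕ)) (λ E → Σ (List (List ℕ)) (λ O → Σ (List (List ℕ)) (λ D →
            Enumerates (λ xs → InCmn m n xs × ℓr xs % 2 ≡ 0) E
          × Enumerates (λ xs → InCmn m n xs × ℓr xs % 2 ≡ 1) O
          × Enumerates (InODmn m n) D
          × length E ≡ length O + length D))))
theorem3p3 =
  (ψ , (λ _ → ψ-InC) , (λ xs _ → ψ-involutive xs) , (λ _ → ψ-fixed⇔InOD) , (λ _ → ψ-moves)) ,
  λ m n _ → E[ m , n ] , O[ m , n ] , D[ m , n ] ,
            E-enumerates m n , O-enumerates m n , D-enumerates m n , count-identity m n
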